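{- As formal power series in $q$, \[ (-q;q)_\infty = \sum_{n\geq k\geq 0} q^{n(2n-1) + 3k}\, Y_{q^2}(2n-k,k)\,(q^2;q^2)_{2n}^{ -1}\,[2(n-k)+1]_q . \]
   Context: $(a;q)_k=\prod_{j=0}^{k-1}(1-aq^j)$, $(a;q)_0=1$, $(a;q)_\infty=\prod_{j\ge0}(1-aq^j)$ (and likewise with base $q^2$). For $m\ge 0$: $[m]_q=1+q+\cdots+q^{m-1}$, $[m]_q!=[m]_q[m-1]_q\cdots[1]_q$, and for $m\ge j\ge 0$, $\begin{bmatrix} m\\ j\end{bmatrix}_q=\frac{[m]_q!}{[j]_q![m-j]_q!}$. For $m\ge j\ge 0$ the $q$-Yamanouchi number is $Y_q(m,j)=\frac{[m-j+1]_q}{[m+1]_q}\begin{bmatrix} m+j\\ m\end{bmatrix}_q$; $Y_{q^2}$ denotes this with $q$ replaced by $q^2$. -}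

module Defs where

open import Data.Nat as ℕ using (ℕ; zero; suc; _∸_)
open import Data.Integer as ℤ using (ℤ; +_; -_)
open import Data.List using (List; []; _∷_; upTo; map; zipWith; foldr)
open import Data.Bool using (if_then_else_)

FPS : Set
FPS = ℕ → ℤ

sumℤ : List ℤ → ℤ
sumℤ = foldr ℤ._+_ (+ 0)

Σ≤ : ℕ → (ℕ → ℤ) → ℤ
Σ≤ n f = sumℤ (map f (upTo (suc n)))

𝟘 : FPS
𝟘 _ = + 0

𝟙 : FPS
𝟙 zero    = + 1
𝟙 (suc _) = + 0

X^ : ℕ → FPS
X^ d n = if d ℕ.≡ᵇ n then + 1 else + 0

_⊕_ : FPS → FPS → FPS
(f ⊕ g) n = f n ℤ.+ g n

_⊖_ : FPS → FPS → FPS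
(f ⊖ g) n = f n ℤ.- g n

_·_ : ℤ → FPS → FPS
(c · f) n = c ℤ.* f n

_⊗_ : FPS → FPS → FPS
(f ⊗ g) n = Σ≤ n (λ i → f i ℤ.* g (n ∸ i))

infixl 6 _⊕_ _⊖_
infixl 7 _⊗_ _·_

∏< : ℕ → (ℕ → FPS) → FPS
∏< zero    F = 𝟙
∏< (suc k) F = ∏< k F ⊗ F k

Σ< : ℕ → (ℕ → FPS) → FPS
Σ< zero    F = 𝟘
Σ< (suc k) F = Σ< k F ⊕ F k

-- Multiplicative inverse of a series f with constant term 1
-- (g₀ = 1, g_m = - Σ_{i=1}^{m} f_i g_{m-i}).
-- invRev f m = [g_m, g_{m-1}, ..., g_0].
invRev : FPS → ℕ → List ℤ
invRev f zero    = + 1 ∷ []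
invRev f (suc m) =
  (- sumℤ (zipWith ℤ._*_ (map (λ i → f (suc i)) (upTo (suc m))) (invRev f m)))
  ∷ invRev f m

head0 : List ℤ → ℤ
head0 []      = + 0
head0 (x ∷ _) = x

inv : FPS → FPS
inv f m = head0 (invRev f m)

-- All q-notions below are taken with base p = q^b (b = 1 gives base q,
-- b = 2 gives base q^2, i.e. "q replaced by q^2").

qint : ℕ → ℕ → FPS
qint b m = Σ< m (λ j → X^ (b ℕ.* j))

qfact : ℕ → ℕ → FPS
qfact b m = ∏< m (λ j → qint b (suc j))

qbinom : ℕ → ℕ → ℕ → FPS
qbinom b m j = qfact b m ⊗ inv (qfact b j ⊗ qfact b (m ∸ j))

Yam : ℕ → ℕ → ℕ → FPS
Yam b m j = qint b (suc (m ∸ j)) ⊗ inv (qint b (suc m)) ⊗ qbinom b (m ℕ.+ j) m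

-- (a;q^b)_k with a = c q^e : ∏_{j<k} (1 - c q^{e + b j})
poch : ℤ → ℕ → ℕ → ℕ → FPS
poch c e b k = ∏< k (λ j → 𝟙 ⊖ c · X^ (e ℕ.+ b ℕ.* j))

-- (a;q^b)_∞ with a = c q^e, e ≥ 1, b ≥ 1: the product converges q-adically,
-- since factor j is ≡ 1 mod q^{j+1}; its N-th coefficient is the N-th
-- coefficient of the product of the first N+1 factors.
pochInf : ℤ → ℕ → ℕ → FPS
pochInf c e b N = poch c e b (suc N) N

-- Sum over n ≥ k ≥ 0 of a family T n k of series with ord (T n k) ≥ n:
-- the N-th coefficient only receives contributions from n ≤ N.
Σ-n≥k : (ℕ → ℕ → FPS) → FPS
Σ-n≥k T N = Σ≤ N (λ n → Σ≤ n (λ k → T n k N))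

term : ℕ → ℕ → FPS
term n k =
  X^ (n ℕ.* (2 ℕ.* n ∸ 1) ℕ.+ 3 ℕ.* k)
  ⊗ Yam 2 (2 ℕ.* n ∸ k) k
  ⊗ inv (poch (+ 1) 2 2 (2 ℕ.* n))
  ⊗ qint 1 (suc (2 ℕ.* (n ∸ k)))

minusqInf : FPS
minusqInf = pochInf (- (+ 1)) 1 1

-- Since Y_{q²}(2n−k, k) = [2n k]_{q²} − q^{2(2(n−k)+1)} [2n k−1]_{q²}, after multiplication by 1 − q
-- the sum over k of q^{3k} Y_{q²}(2n−k, k) [2(n−k)+1]_q telescopes, through the symmetry k ↔ 2n − k,
-- into Σₖ q^{3k} [2n k]_{q²} − q^{2n+1} Σₖ q^k [2n k]_{q²}; the q-Pascal rule evaluates both sums in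
-- terms of (−q;q)_{2n}, giving Σₖ term n k = q^{n(2n−1)} / (q;q)_{2n}. What remains is half of Euler's
-- expansion (−1;q)_∞ = Σₘ q^{m(m−1)/2} / (q;q)_m = 2 (−q;q)_∞: the even and odd parts of
-- Σₘ q^{m(m−1)/2} [M m]_q both equal (−q;q)_{M−1}, and [M 2n]_q agrees with 1/(q;q)_{2n} in all
-- degrees that can affect the coefficient of q^N.

module Submission where

open import Defs
open import Data.Nat as ℕ using (ℕ; zero; suc; _∸_; _≡ᵇ_; z≤n; s≤s)
import Data.Nat.Properties as ℕP
open import Data.Nat.Tactic.RingSolver using (solve-∀)
open import Data.Integer as ℤ using (ℤ; +_; -_; _+_; _*_; _-_)
import Data.Integer.Properties as ℤP
open import Data.List using (_∷_; upTo; map; applyUpTo; zipWith)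
open import Data.Bool using (if_then_else_)
open import Data.Maybe using (Maybe; nothing; just)
open import Data.Product using (_×_; _,_; proj₁; proj₂)
open import Function using (_∘_)
open import Level using (0ℓ)
open import Relation.Nullary using (yes; no)
open import Relation.Binary.PropositionalEquality as Eq using (_≡_; refl; cong; cong₂)
open import Algebra.Bundles using (CommutativeRing)
import Algebra.Construct.Pointwise as Pointwise
import Algebra.Properties.CommutativeSemigroup as CSemigroupProperties
open import Algebra.Solver.Ring.AlmostCommutativeRing
  using (fromCommutativeRing; _-Raw-AlmostCommutative⟶_)
import Algebra.Solver.Ring
import Relation.Binary.Reasoning.Setoid as SetoidReasoning

∑ : ℕ → (ℕ → ℤ) → ℤ
∑ zero    f = + 0
∑ (suc n) f = ∑ n f + f n

∑-suc : ∀ n f → ∑ (suc n) f ≡ f 0 + ∑ n (f ∘ suc)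
∑-suc zero    f = Eq.trans (ℤP.+-identityˡ (f 0)) (Eq.sym (ℤP.+-identityʳ (f 0)))
∑-suc (suc n) f = begin
  ∑ (suc n) f + f (suc n)         ≡⟨ cong (_+ f (suc n)) (∑-suc n f) ⟩
  f 0 + ∑ n (f ∘ suc) + f (suc n) ≡⟨ ℤP.+-assoc (f 0) _ _ ⟩
  f 0 + ∑ (suc n) (f ∘ suc)       ∎
  where open Eq.≡-Reasoning

sum-applyUpTo : ∀ n (f : ℕ → ℤ) (g : ℕ → ℕ) → sumℤ (map f (applyUpTo g n)) ≡ ∑ n (f ∘ g)
sum-applyUpTo zero    f g = refl
sum-applyUpTo (suc n) f g =
  Eq.trans (cong (λ x → f (g 0) + x) (sum-applyUpTo n f (g ∘ suc))) (Eq.sym (∑-suc n (f ∘ g)))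

Σ≤≡∑ : ∀ n f → Σ≤ n f ≡ ∑ (suc n) f
Σ≤≡∑ n f = sum-applyUpTo (suc n) f (λ i → i)

∑-cong : ∀ n {f g} → (∀ i → i ℕ.< n → f i ≡ g i) → ∑ n f ≡ ∑ n g
∑-cong zero    f≡g = refl
∑-cong (suc n) f≡g = cong₂ _+_ (∑-cong n (λ i i<n → f≡g i (ℕP.m<n⇒m<1+n i<n))) (f≡g n ℕP.≤-refl)

∑-zero : ∀ n → ∑ n (λ _ → + 0) ≡ + 0
∑-zero zero    = refl
∑-zero (suc n) = Eq.trans (ℤP.+-identityʳ _) (∑-zero n)

∑-+ : ∀ n f g → ∑ n (λ i → f i + g i) ≡ ∑ n f + ∑ n g
∑-+ zero    f g = refl
∑-+ (suc n) f g = Eq.trans (cong (_+ (f n + g n)) (∑-+ n f g))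
                           (CSemigroupProperties.interchange ℤP.+-commutativeSemigroup (∑ n f) (∑ n g) (f n) (g n))

∑-*ˡ : ∀ n c f → ∑ n (λ i → c * f i) ≡ c * ∑ n f
∑-*ˡ zero    c f = Eq.sym (ℤP.*-zeroʳ c)
∑-*ˡ (suc n) c f = Eq.trans (cong (_+ (c * f n)) (∑-*ˡ n c f)) (Eq.sym (ℤP.*-distribˡ-+ c (∑ n f) (f n)))

∑-*ʳ : ∀ n c f → ∑ n (λ i → f i * c) ≡ ∑ n f * c
∑-*ʳ n c f = Eq.trans (∑-cong n (λ i _ → ℤP.*-comm (f i) c)) (Eq.trans (∑-*ˡ n c f) (ℤP.*-comm c _))

∑-split : ∀ m n f → ∑ (m ℕ.+ n) f ≡ ∑ m f + ∑ n (λ i → f (m ℕ.+ i))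
∑-split m zero    f = Eq.trans (cong (λ k → ∑ k f) (ℕP.+-identityʳ m)) (Eq.sym (ℤP.+-identityʳ _))
∑-split m (suc n) f = begin
  ∑ (m ℕ.+ suc n) f                                 ≡⟨ cong (λ k → ∑ k f) (ℕP.+-suc m n) ⟩
  ∑ (m ℕ.+ n) f + f (m ℕ.+ n)                       ≡⟨ cong (_+ f (m ℕ.+ n)) (∑-split m n f) ⟩
  ∑ m f + ∑ n (λ i → f (m ℕ.+ i)) + f (m ℕ.+ n)     ≡⟨ ℤP.+-assoc (∑ m f) _ _ ⟩
  ∑ m f + ∑ (suc n) (λ i → f (m ℕ.+ i))             ∎
  where open Eq.≡-Reasoning

∑-reverse : ∀ n f → ∑ n f ≡ ∑ n (λ i → f (n ∸ suc i))
∑-reverse zero    f = refl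
∑-reverse (suc n) f = begin
  ∑ n f + f n                          ≡⟨ ℤP.+-comm (∑ n f) (f n) ⟩
  f n + ∑ n f                          ≡⟨ cong (λ x → f n + x) (∑-reverse n f) ⟩
  f n + ∑ n (λ i → f (n ∸ suc i))      ≡⟨ Eq.sym (∑-suc n (λ i → f (suc n ∸ suc i))) ⟩
  ∑ (suc n) (λ i → f (suc n ∸ suc i))  ∎
  where open Eq.≡-Reasoning

∑-triangle : ∀ n (F : ℕ → ℕ → ℤ) →
  ∑ (suc n) (λ i → ∑ (suc i) (F i)) ≡ ∑ (suc n) (λ j → ∑ (suc (n ∸ j)) (λ k → F (j ℕ.+ k) j))
∑-triangle zero    F = refl
∑-triangle (suc n) F = begin
  ∑ (suc n) (λ i → ∑ (suc i) (F i)) + ∑ (suc (suc n)) (F (suc n))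
    ≡⟨ cong (_+ ∑ (suc (suc n)) (F (suc n))) (∑-triangle n F) ⟩
  Cols n + (∑ (suc n) (F (suc n)) + F (suc n) (suc n))
    ≡⟨ Eq.sym (ℤP.+-assoc (Cols n) _ _) ⟩
  Cols n + ∑ (suc n) (F (suc n)) + F (suc n) (suc n)
    ≡⟨ cong (_+ F (suc n) (suc n)) (Eq.sym (∑-+ (suc n) _ _)) ⟩
  ∑ (suc n) (λ j → ∑ (suc (n ∸ j)) (λ k → F (j ℕ.+ k) j) + F (suc n) j) + F (suc n) (suc n)
    ≡⟨ cong₂ _+_ (∑-cong (suc n) extend-column) (cong (λ x → F x (suc n)) (Eq.sym (ℕP.+-identityʳ (suc n)))) ⟩
  ∑ (suc n) (λ j → ∑ (suc (suc n ∸ j)) (λ k → F (j ℕ.+ k) j)) + F (suc n ℕ.+ 0) (suc n)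
    ≡⟨ cong (λ x → ∑ (suc n) (λ j → ∑ (suc (suc n ∸ j)) (λ k → F (j ℕ.+ k) j)) + x) last-column ⟩
  Cols (suc n) ∎
  where
  open Eq.≡-Reasoning
  Cols : ℕ → ℤ
  Cols m = ∑ (suc m) (λ j → ∑ (suc (m ∸ j)) (λ k → F (j ℕ.+ k) j))
  last-column : F (suc n ℕ.+ 0) (suc n) ≡ ∑ (suc (n ∸ n)) (λ k → F (suc n ℕ.+ k) (suc n))
  last-column rewrite ℕP.n∸n≡0 n = Eq.sym (ℤP.+-identityˡ _)
  extend-column : ∀ j → j ℕ.< suc n →
    ∑ (suc (n ∸ j)) (λ k → F (j ℕ.+ k) j) + F (suc n) j ≡ ∑ (suc (suc n ∸ j)) (λ k → F (j ℕ.+ k) j)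
  extend-column j (s≤s j≤n) rewrite ℕP.+-∸-assoc 1 j≤n =
    cong (λ x → ∑ (suc (n ∸ j)) (λ k → F (j ℕ.+ k) j) + F x j)
      (Eq.trans (cong suc (Eq.sym (ℕP.m+[n∸m]≡n j≤n))) (Eq.sym (ℕP.+-suc j (n ∸ j))))

infix 4 _≈_
_≈_ : FPS → FPS → Set
f ≈ g = ∀ n → f n ≡ g n

neg : FPS → FPS
neg f n = - f n

⊗-coeff : ∀ f g n → (f ⊗ g) n ≡ ∑ (suc n) (λ i → f i * g (n ∸ i))
⊗-coeff f g n = Σ≤≡∑ n _

⊗-cong : ∀ {f f′ g g′} → f ≈ f′ → g ≈ g′ → f ⊗ g ≈ f′ ⊗ g′
⊗-cong {f} {f′} {g} {g′} f≈f′ g≈g′ n = Eq.trans (⊗-coeff f g n) (Eq.trans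
  (∑-cong (suc n) (λ i _ → cong₂ _*_ (f≈f′ i) (g≈g′ (n ∸ i)))) (Eq.sym (⊗-coeff f′ g′ n)))

⊗-comm : ∀ f g → f ⊗ g ≈ g ⊗ f
⊗-comm f g n = begin
  (f ⊗ g) n                                     ≡⟨ ⊗-coeff f g n ⟩
  ∑ (suc n) (λ i → f i * g (n ∸ i))             ≡⟨ ∑-reverse (suc n) _ ⟩
  ∑ (suc n) (λ i → f (n ∸ i) * g (n ∸ (n ∸ i))) ≡⟨ ∑-cong (suc n) swap ⟩
  ∑ (suc n) (λ i → g i * f (n ∸ i))             ≡⟨ Eq.sym (⊗-coeff g f n) ⟩
  (g ⊗ f) n                                     ∎
  where
  open Eq.≡-Reasoning
  swap : ∀ i → i ℕ.< suc n → f (n ∸ i) * g (n ∸ (n ∸ i)) ≡ g i * f (n ∸ i)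
  swap i i<1+n = Eq.trans (ℤP.*-comm (f (n ∸ i)) _) (cong (λ k → g k * f (n ∸ i)) (ℕP.m∸[m∸n]≡n (ℕP.≤-pred i<1+n)))

⊗-assoc : ∀ f g h → (f ⊗ g) ⊗ h ≈ f ⊗ (g ⊗ h)
⊗-assoc f g h n = begin
  ((f ⊗ g) ⊗ h) n
    ≡⟨ ⊗-coeff (f ⊗ g) h n ⟩
  ∑ (suc n) (λ i → (f ⊗ g) i * h (n ∸ i))
    ≡⟨ ∑-cong (suc n) (λ i _ → Eq.trans (cong (_* h (n ∸ i)) (⊗-coeff f g i)) (Eq.sym (∑-*ʳ (suc i) _ _))) ⟩
  ∑ (suc n) (λ i → ∑ (suc i) (λ j → f j * g (i ∸ j) * h (n ∸ i)))
    ≡⟨ ∑-triangle n (λ i j → f j * g (i ∸ j) * h (n ∸ i)) ⟩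
  ∑ (suc n) (λ j → ∑ (suc (n ∸ j)) (λ k → f j * g ((j ℕ.+ k) ∸ j) * h (n ∸ (j ℕ.+ k))))
    ≡⟨ ∑-cong (suc n) (λ j _ → ∑-cong (suc (n ∸ j)) (λ k _ → reindex j k)) ⟩
  ∑ (suc n) (λ j → ∑ (suc (n ∸ j)) (λ k → f j * (g k * h (n ∸ j ∸ k))))
    ≡⟨ ∑-cong (suc n) (λ j _ → Eq.trans (∑-*ˡ (suc (n ∸ j)) (f j) _) (cong (f j *_) (Eq.sym (⊗-coeff g h (n ∸ j))))) ⟩
  ∑ (suc n) (λ j → f j * (g ⊗ h) (n ∸ j))
    ≡⟨ Eq.sym (⊗-coeff f (g ⊗ h) n) ⟩
  (f ⊗ (g ⊗ h)) n ∎
  where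
  open Eq.≡-Reasoning
  reindex : ∀ j k → f j * g ((j ℕ.+ k) ∸ j) * h (n ∸ (j ℕ.+ k)) ≡ f j * (g k * h (n ∸ j ∸ k))
  reindex j k = Eq.trans (cong₂ (λ a b → f j * g a * h b) (ℕP.m+n∸m≡n j k) (Eq.sym (ℕP.∸-+-assoc n j k)))
                         (ℤP.*-assoc (f j) _ _)

⊗-distribˡ : ∀ f g h → f ⊗ (g ⊕ h) ≈ f ⊗ g ⊕ f ⊗ h
⊗-distribˡ f g h n = begin
  (f ⊗ (g ⊕ h)) n
    ≡⟨ ⊗-coeff f (g ⊕ h) n ⟩
  ∑ (suc n) (λ i → f i * (g (n ∸ i) + h (n ∸ i)))
    ≡⟨ ∑-cong (suc n) (λ i _ → ℤP.*-distribˡ-+ (f i) _ _) ⟩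
  ∑ (suc n) (λ i → f i * g (n ∸ i) + f i * h (n ∸ i))
    ≡⟨ ∑-+ (suc n) _ _ ⟩
  ∑ (suc n) (λ i → f i * g (n ∸ i)) + ∑ (suc n) (λ i → f i * h (n ∸ i))
    ≡⟨ Eq.sym (cong₂ _+_ (⊗-coeff f g n) (⊗-coeff f h n)) ⟩
  (f ⊗ g ⊕ f ⊗ h) n ∎
  where open Eq.≡-Reasoning

⊗-distribʳ : ∀ f g h → (g ⊕ h) ⊗ f ≈ g ⊗ f ⊕ h ⊗ f
⊗-distribʳ f g h n = Eq.trans (⊗-comm (g ⊕ h) f n)
  (Eq.trans (⊗-distribˡ f g h n) (cong₂ _+_ (⊗-comm f g n) (⊗-comm f h n)))

⊗-identityˡ : ∀ f → 𝟙 ⊗ f ≈ f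
⊗-identityˡ f n = begin
  (𝟙 ⊗ f) n                                                ≡⟨ ⊗-coeff 𝟙 f n ⟩
  ∑ (suc n) (λ i → 𝟙 i * f (n ∸ i))                        ≡⟨ ∑-suc n _ ⟩
  + 1 * f n + ∑ n (λ i → + 0 * f (n ∸ suc i))              ≡⟨ cong₂ _+_ (ℤP.*-identityˡ (f n)) zeros ⟩
  f n + + 0                                                ≡⟨ ℤP.+-identityʳ (f n) ⟩
  f n                                                      ∎
  where
  open Eq.≡-Reasoning
  zeros : ∑ n (λ i → + 0 * f (n ∸ suc i)) ≡ + 0
  zeros = Eq.trans (∑-cong n (λ i _ → ℤP.*-zeroˡ (f (n ∸ suc i)))) (∑-zero n)

⊗-identityʳ : ∀ f → f ⊗ 𝟙 ≈ f
⊗-identityʳ f n = Eq.trans (⊗-comm f 𝟙 n) (⊗-identityˡ f n)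

FPS-commutativeRing : CommutativeRing 0ℓ 0ℓ
FPS-commutativeRing = record
  { Carrier = FPS ; _≈_ = _≈_ ; _+_ = _⊕_ ; _*_ = _⊗_ ; -_ = neg ; 0# = 𝟘 ; 1# = 𝟙
  ; isCommutativeRing = record
    { isRing = record
      { +-isAbelianGroup = Pointwise.isAbelianGroup ℕ ℤP.+-0-isAbelianGroup
      ; *-cong           = ⊗-cong
      ; *-assoc          = ⊗-assoc
      ; *-identity       = ⊗-identityˡ , ⊗-identityʳ
      ; distrib          = ⊗-distribˡ , ⊗-distribʳ
      }
    ; *-comm = ⊗-comm
    }
  }

·-⊗ : ∀ c f g → (c · f) ⊗ g ≈ c · (f ⊗ g)
·-⊗ c f g n = Eq.trans (⊗-coeff (c · f) g n) (Eq.trans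
  (∑-cong (suc n) (λ i _ → ℤP.*-assoc c (f i) (g (n ∸ i))))
  (Eq.trans (∑-*ˡ (suc n) c _) (cong (c *_) (Eq.sym (⊗-coeff f g n)))))

-- Lets the ring solver use integer constants, read as c · 𝟙.
ℤ⟶FPS : ℤ.+-*-rawRing -Raw-AlmostCommutative⟶ fromCommutativeRing FPS-commutativeRing
ℤ⟶FPS = record
  { ⟦_⟧    = λ c → c · 𝟙
  ; +-homo = λ c d n → ℤP.*-distribʳ-+ (𝟙 n) c d
  ; *-homo = λ c d n → Eq.sym (Eq.trans (·-⊗ c 𝟙 (d · 𝟙) n)
               (Eq.trans (cong (c *_) (⊗-identityˡ (d · 𝟙) n)) (Eq.sym (ℤP.*-assoc c d (𝟙 n)))))
  ; -‿homo = λ c n → Eq.sym (ℤP.neg-distribˡ-* c (𝟙 n))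
  ; 0-homo = λ n → ℤP.*-zeroˡ (𝟙 n)
  ; 1-homo = λ n → ℤP.*-identityˡ (𝟙 n)
  }

constants-equal? : ∀ c d → Maybe (c · 𝟙 ≈ d · 𝟙)
constants-equal? c d with c ℤP.≟ d
... | yes refl = just (λ _ → refl)
... | no _     = nothing

open Algebra.Solver.Ring ℤ.+-*-rawRing (fromCommutativeRing FPS-commutativeRing) ℤ⟶FPS constants-equal?
  using (solve; _:=_; _:+_; _:*_; _:-_; :-_; con)
module ≈-Reasoning = SetoidReasoning (CommutativeRing.setoid FPS-commutativeRing)

≈-refl : ∀ {f} → f ≈ f
≈-refl _ = refl

≈-sym : ∀ {f g} → f ≈ g → g ≈ f
≈-sym f≈g n = Eq.sym (f≈g n)

≈-trans : ∀ {f g h} → f ≈ g → g ≈ h → f ≈ h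
≈-trans f≈g g≈h n = Eq.trans (f≈g n) (g≈h n)

⊕-cong : ∀ {f f′ g g′} → f ≈ f′ → g ≈ g′ → f ⊕ g ≈ f′ ⊕ g′
⊕-cong f≈f′ g≈g′ n = cong₂ _+_ (f≈f′ n) (g≈g′ n)

⊖-cong : ∀ {f f′ g g′} → f ≈ f′ → g ≈ g′ → f ⊖ g ≈ f′ ⊖ g′
⊖-cong f≈f′ g≈g′ n = cong₂ _-_ (f≈f′ n) (g≈g′ n)

⊗-congˡ : ∀ {f f′} g → f ≈ f′ → f ⊗ g ≈ f′ ⊗ g
⊗-congˡ g f≈f′ = ⊗-cong f≈f′ (≈-refl {g})

⊗-congʳ : ∀ f {g g′} → g ≈ g′ → f ⊗ g ≈ f ⊗ g′
⊗-congʳ f g≈g′ = ⊗-cong (≈-refl {f}) g≈g′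

⊗-zeroˡ : ∀ f → 𝟘 ⊗ f ≈ 𝟘
⊗-zeroˡ f n = Eq.trans (⊗-coeff 𝟘 f n) (Eq.trans (∑-cong (suc n) (λ i _ → ℤP.*-zeroˡ (f (n ∸ i)))) (∑-zero (suc n)))

⊗-zeroʳ : ∀ f → f ⊗ 𝟘 ≈ 𝟘
⊗-zeroʳ f = ≈-trans (⊗-comm f 𝟘) (⊗-zeroˡ f)

⊕-identityʳ : ∀ f → f ⊕ 𝟘 ≈ f
⊕-identityʳ f n = ℤP.+-identityʳ (f n)

·-identityˡ : ∀ f → (+ 1) · f ≈ f
·-identityˡ f n = ℤP.*-identityˡ (f n)

𝟙≈con1 : 𝟙 ≈ (+ 1) · 𝟙
𝟙≈con1 = ≈-sym (·-identityˡ 𝟙)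

X^-≡ : ∀ {a b} → a ≡ b → X^ a ≈ X^ b
X^-≡ refl = ≈-refl

X^-below : ∀ {d n} → n ℕ.< d → X^ d n ≡ + 0
X^-below {suc d} {zero}  _       = refl
X^-below {suc d} {suc n} (s≤s p) = X^-below {d} {n} p

X^-diag : ∀ d → X^ d d ≡ + 1
X^-diag zero    = refl
X^-diag (suc d) = X^-diag d

X^-above : ∀ {d n} → d ℕ.< n → X^ d n ≡ + 0
X^-above {zero}  {suc n} _       = refl
X^-above {suc d} {suc n} (s≤s p) = X^-above {d} {n} p

X^0≈𝟙 : X^ 0 ≈ 𝟙
X^0≈𝟙 zero    = refl
X^0≈𝟙 (suc n) = refl

X^⊗-coeff-below : ∀ a f n → n ℕ.< a → (X^ a ⊗ f) n ≡ + 0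
X^⊗-coeff-below a f n n<a = Eq.trans (⊗-coeff (X^ a) f n) (Eq.trans
  (∑-cong (suc n) (λ i i≤n → Eq.trans (cong (_* f (n ∸ i)) (X^-below (ℕP.<-≤-trans i≤n n<a))) (ℤP.*-zeroˡ (f (n ∸ i)))))
  (∑-zero (suc n)))

X^⊗-coeff : ∀ a f n → a ℕ.≤ n → (X^ a ⊗ f) n ≡ f (n ∸ a)
X^⊗-coeff a f n a≤n = begin
  (X^ a ⊗ f) n
    ≡⟨ ⊗-coeff (X^ a) f n ⟩
  ∑ (suc n) (λ i → X^ a i * f (n ∸ i))
    ≡⟨ cong (λ k → ∑ k (λ i → X^ a i * f (n ∸ i))) (Eq.sym split-point) ⟩
  ∑ (a ℕ.+ suc (n ∸ a)) (λ i → X^ a i * f (n ∸ i))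
    ≡⟨ ∑-split a (suc (n ∸ a)) _ ⟩
  ∑ a (λ i → X^ a i * f (n ∸ i)) + ∑ (suc (n ∸ a)) (λ i → X^ a (a ℕ.+ i) * f (n ∸ (a ℕ.+ i)))
    ≡⟨ cong₂ _+_ below (∑-suc (n ∸ a) _) ⟩
  + 0 + (X^ a (a ℕ.+ 0) * f (n ∸ (a ℕ.+ 0)) + ∑ (n ∸ a) (λ i → X^ a (a ℕ.+ suc i) * f (n ∸ (a ℕ.+ suc i))))
    ≡⟨ Eq.trans (ℤP.+-identityˡ _) (cong₂ _+_ (cong (λ k → X^ a k * f (n ∸ k)) (ℕP.+-identityʳ a)) above) ⟩
  X^ a a * f (n ∸ a) + + 0
    ≡⟨ Eq.trans (ℤP.+-identityʳ _) (Eq.trans (cong (_* f (n ∸ a)) (X^-diag a)) (ℤP.*-identityˡ _)) ⟩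
  f (n ∸ a) ∎
  where
  open Eq.≡-Reasoning
  split-point : a ℕ.+ suc (n ∸ a) ≡ suc n
  split-point = Eq.trans (ℕP.+-suc a (n ∸ a)) (cong suc (ℕP.m+[n∸m]≡n a≤n))
  below : ∑ a (λ i → X^ a i * f (n ∸ i)) ≡ + 0
  below = Eq.trans (∑-cong a (λ i i<a → Eq.trans (cong (_* f (n ∸ i)) (X^-below i<a)) (ℤP.*-zeroˡ (f (n ∸ i)))))
                   (∑-zero a)
  above : ∑ (n ∸ a) (λ i → X^ a (a ℕ.+ suc i) * f (n ∸ (a ℕ.+ suc i))) ≡ + 0
  above = Eq.trans (∑-cong (n ∸ a) (λ i _ → Eq.trans (cong (_* f (n ∸ (a ℕ.+ suc i))) (X^-above (ℕP.m<m+n a (s≤s z≤n))))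
                                                     (ℤP.*-zeroˡ (f (n ∸ (a ℕ.+ suc i))))))
                   (∑-zero (n ∸ a))

≡ᵇ-shift : ∀ a b n → a ℕ.≤ n → (a ℕ.+ b ≡ᵇ n) ≡ (b ≡ᵇ n ∸ a)
≡ᵇ-shift zero    b n       _       = refl
≡ᵇ-shift (suc a) b (suc n) (s≤s p) = ≡ᵇ-shift a b n p

X^-+ : ∀ a b → X^ a ⊗ X^ b ≈ X^ (a ℕ.+ b)
X^-+ a b n with a ℕ.≤? n
... | yes a≤n = Eq.trans (X^⊗-coeff a (X^ b) n a≤n)
                         (cong (λ c → if c then + 1 else + 0) (Eq.sym (≡ᵇ-shift a b n a≤n)))
... | no a≰n  = Eq.trans (X^⊗-coeff-below a (X^ b) n (ℕP.≰⇒> a≰n))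
                         (Eq.sym (X^-below (ℕP.<-≤-trans (ℕP.≰⇒> a≰n) (ℕP.m≤m+n a b))))

X^-swap : ∀ a b c d g → a ℕ.+ b ≡ c ℕ.+ d → X^ a ⊗ (X^ b ⊗ g) ≈ X^ c ⊗ (X^ d ⊗ g)
X^-swap a b c d g a+b≡c+d = begin
  X^ a ⊗ (X^ b ⊗ g)   ≈⟨ ≈-sym (⊗-assoc (X^ a) (X^ b) g) ⟩
  X^ a ⊗ X^ b ⊗ g     ≈⟨ ⊗-congˡ g (≈-trans (X^-+ a b) (≈-trans (X^-≡ a+b≡c+d) (≈-sym (X^-+ c d)))) ⟩
  X^ c ⊗ X^ d ⊗ g     ≈⟨ ⊗-assoc (X^ c) (X^ d) g ⟩
  X^ c ⊗ (X^ d ⊗ g)   ∎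
  where open ≈-Reasoning

ConstOne : FPS → Set
ConstOne f = f 0 ≡ + 1

ConstOne-⊗ : ∀ {f g} → ConstOne f → ConstOne g → ConstOne (f ⊗ g)
ConstOne-⊗ {f} {g} f₀ g₀ = Eq.trans (⊗-coeff f g 0) (Eq.trans (ℤP.+-identityˡ _) (cong₂ _*_ f₀ g₀))

ConstOne-poch : ∀ c e b M → ConstOne (poch c (suc e) b M)
ConstOne-poch c e b zero    = refl
ConstOne-poch c e b (suc M) =
  ConstOne-⊗ {poch c (suc e) b M} {𝟙 ⊖ c · X^ (suc e ℕ.+ b ℕ.* M)} (ConstOne-poch c e b M) (cong (λ z → + 1 - z) (ℤP.*-zeroʳ c))

zipWith-map : ∀ k (g h : ℕ → ℤ) (e : ℕ → ℕ) →
  zipWith _*_ (map g (applyUpTo e k)) (map h (applyUpTo e k)) ≡ map (λ i → g i * h i) (applyUpTo e k)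
zipWith-map zero    g h e = refl
zipWith-map (suc k) g h e = cong (g (e 0) * h (e 0) ∷_) (zipWith-map k g h (e ∘ suc))

map-applyUpTo : ∀ k (g : ℕ → ℤ) (e : ℕ → ℕ) → map g (applyUpTo e k) ≡ applyUpTo (g ∘ e) k
map-applyUpTo zero    g e = refl
map-applyUpTo (suc k) g e = cong (g (e 0) ∷_) (map-applyUpTo k g (e ∘ suc))

invRev≡map : ∀ f m → invRev f m ≡ map (λ i → inv f (m ∸ i)) (upTo (suc m))
invRev≡map f zero    = refl
invRev≡map f (suc m) = cong (inv f (suc m) ∷_) (Eq.trans (invRev≡map f m) (Eq.trans
  (map-applyUpTo (suc m) (λ i → inv f (m ∸ i)) (λ i → i))
  (Eq.sym (map-applyUpTo (suc m) (λ i → inv f (suc m ∸ i)) suc))))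

inv-suc : ∀ f m → inv f (suc m) ≡ - ∑ (suc m) (λ i → f (suc i) * inv f (m ∸ i))
inv-suc f m = cong -_ (Eq.trans
  (cong (λ l → sumℤ (zipWith _*_ (map (λ i → f (suc i)) (upTo (suc m))) l)) (invRev≡map f m))
  (Eq.trans (cong sumℤ (zipWith-map (suc m) (λ i → f (suc i)) (λ i → inv f (m ∸ i)) (λ i → i)))
            (sum-applyUpTo (suc m) _ (λ i → i))))

⊗-inv : ∀ f → ConstOne f → f ⊗ inv f ≈ 𝟙
⊗-inv f f₀ zero    = Eq.trans (⊗-coeff f (inv f) 0) (Eq.trans (ℤP.+-identityˡ _) (cong (_* + 1) f₀))
⊗-inv f f₀ (suc m) = begin
  (f ⊗ inv f) (suc m)                             ≡⟨ ⊗-coeff f (inv f) (suc m) ⟩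
  ∑ (suc (suc m)) (λ i → f i * inv f (suc m ∸ i)) ≡⟨ ∑-suc (suc m) _ ⟩
  f 0 * inv f (suc m) + T                         ≡⟨ cong₂ (λ a b → a * b + T) f₀ (inv-suc f m) ⟩
  + 1 * (- T) + T                                 ≡⟨ cong (_+ T) (ℤP.*-identityˡ (- T)) ⟩
  - T + T                                         ≡⟨ ℤP.+-inverseˡ T ⟩
  + 0                                             ∎
  where
  open Eq.≡-Reasoning
  T = ∑ (suc m) (λ i → f (suc i) * inv f (m ∸ i))

inv-unique : ∀ f h → ConstOne f → f ⊗ h ≈ 𝟙 → h ≈ inv f
inv-unique f h f₀ f⊗h≈𝟙 = begin
  h                 ≈⟨ ≈-sym (⊗-identityʳ h) ⟩
  h ⊗ 𝟙             ≈⟨ ⊗-congʳ h (≈-sym (⊗-inv f f₀)) ⟩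
  h ⊗ (f ⊗ inv f)   ≈⟨ ≈-sym (⊗-assoc h f (inv f)) ⟩
  (h ⊗ f) ⊗ inv f   ≈⟨ ⊗-congˡ (inv f) (≈-trans (⊗-comm h f) f⊗h≈𝟙) ⟩
  𝟙 ⊗ inv f         ≈⟨ ⊗-identityˡ (inv f) ⟩
  inv f             ∎
  where open ≈-Reasoning

inv-cong : ∀ {f g} → ConstOne g → f ≈ g → inv f ≈ inv g
inv-cong {f} {g} g₀ f≈g = inv-unique g (inv f) g₀ (≈-trans (⊗-congˡ (inv f) (≈-sym f≈g)) (⊗-inv f (Eq.trans (f≈g 0) g₀)))

inv-⊗ : ∀ f g → ConstOne f → ConstOne g → inv (f ⊗ g) ≈ inv f ⊗ inv g
inv-⊗ f g f₀ g₀ = ≈-sym (inv-unique (f ⊗ g) (inv f ⊗ inv g) (ConstOne-⊗ {f} {g} f₀ g₀) (begin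
  f ⊗ g ⊗ (inv f ⊗ inv g)
    ≈⟨ solve 4 (λ a b c d → (a :* b :* (c :* d)) := ((a :* c) :* (b :* d))) ≈-refl f g (inv f) (inv g) ⟩
  (f ⊗ inv f) ⊗ (g ⊗ inv g)   ≈⟨ ⊗-cong (⊗-inv f f₀) (⊗-inv g g₀) ⟩
  𝟙 ⊗ 𝟙                       ≈⟨ ⊗-identityˡ 𝟙 ⟩
  𝟙                           ∎))
  where open ≈-Reasoning

⊗-inv-exact : ∀ x d a → ConstOne d → x ⊗ d ≈ a → a ⊗ inv d ≈ x
⊗-inv-exact x d a d₀ x⊗d≈a = begin
  a ⊗ inv d         ≈⟨ ⊗-congˡ (inv d) (≈-sym x⊗d≈a) ⟩
  (x ⊗ d) ⊗ inv d   ≈⟨ ⊗-assoc x d (inv d) ⟩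
  x ⊗ (d ⊗ inv d)   ≈⟨ ⊗-congʳ x (⊗-inv d d₀) ⟩
  x ⊗ 𝟙             ≈⟨ ⊗-identityʳ x ⟩
  x                 ∎
  where open ≈-Reasoning

⊗-cancelʳ : ∀ x y d → ConstOne d → x ⊗ d ≈ y ⊗ d → x ≈ y
⊗-cancelʳ x y d d₀ eq = ≈-trans (≈-sym (⊗-inv-exact x d (x ⊗ d) d₀ ≈-refl)) (⊗-inv-exact y d (x ⊗ d) d₀ (≈-sym eq))

Σ<-coeff : ∀ n F m → Σ< n F m ≡ ∑ n (λ i → F i m)
Σ<-coeff zero    F m = refl
Σ<-coeff (suc n) F m = cong (_+ F n m) (Σ<-coeff n F m)

Σ<-≡ : ∀ {a b} F → a ≡ b → Σ< a F ≈ Σ< b F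
Σ<-≡ F refl = ≈-refl

Σ<-cong : ∀ n {F G} → (∀ i → i ℕ.< n → F i ≈ G i) → Σ< n F ≈ Σ< n G
Σ<-cong n {F} {G} F≈G m = Eq.trans (Σ<-coeff n F m)
  (Eq.trans (∑-cong n (λ i i<n → F≈G i i<n m)) (Eq.sym (Σ<-coeff n G m)))

Σ<-suc : ∀ n F → Σ< (suc n) F ≈ F 0 ⊕ Σ< n (F ∘ suc)
Σ<-suc n F m = Eq.trans (Σ<-coeff (suc n) F m) (Eq.trans (∑-suc n (λ i → F i m))
  (cong (λ z → F 0 m + z) (Eq.sym (Σ<-coeff n (F ∘ suc) m))))

Σ<-⊕ : ∀ n F G → Σ< n (λ i → F i ⊕ G i) ≈ Σ< n F ⊕ Σ< n G
Σ<-⊕ n F G m = Eq.trans (Σ<-coeff n _ m)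
  (Eq.trans (∑-+ n (λ i → F i m) (λ i → G i m)) (Eq.sym (cong₂ _+_ (Σ<-coeff n F m) (Σ<-coeff n G m))))

Σ<-neg : ∀ n F → Σ< n (λ i → neg (F i)) ≈ neg (Σ< n F)
Σ<-neg n F m = Eq.trans (Σ<-coeff n _ m) (Eq.trans
  (Eq.trans (∑-cong n (λ i _ → Eq.sym (ℤP.-1*i≡-i (F i m)))) (∑-*ˡ n (- (+ 1)) (λ i → F i m)))
  (Eq.trans (ℤP.-1*i≡-i _) (cong -_ (Eq.sym (Σ<-coeff n F m)))))

Σ<-⊖ : ∀ n F G → Σ< n (λ i → F i ⊖ G i) ≈ Σ< n F ⊖ Σ< n G
Σ<-⊖ n F G = ≈-trans (Σ<-⊕ n F (λ i → neg (G i))) (⊕-cong (≈-refl {Σ< n F}) (Σ<-neg n G))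

⊗-Σ< : ∀ n f F → f ⊗ Σ< n F ≈ Σ< n (λ i → f ⊗ F i)
⊗-Σ< zero    f F = ⊗-zeroʳ f
⊗-Σ< (suc n) f F = ≈-trans (⊗-distribˡ f (Σ< n F) (F n)) (⊕-cong (⊗-Σ< n f F) (≈-refl {f ⊗ F n}))

Σ<-split : ∀ a n F → Σ< (a ℕ.+ n) F ≈ Σ< a F ⊕ Σ< n (λ i → F (a ℕ.+ i))
Σ<-split a n F m = Eq.trans (Σ<-coeff (a ℕ.+ n) F m) (Eq.trans (∑-split a n (λ i → F i m))
  (Eq.sym (cong₂ _+_ (Σ<-coeff a F m) (Σ<-coeff n (λ i → F (a ℕ.+ i)) m))))

Σ<-reverse : ∀ n F → Σ< n F ≈ Σ< n (λ i → F (n ∸ suc i))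
Σ<-reverse n F m = Eq.trans (Σ<-coeff n F m) (Eq.trans (∑-reverse n (λ i → F i m)) (Eq.sym (Σ<-coeff n _ m)))

∏<-≡ : ∀ {a b} F → a ≡ b → ∏< a F ≈ ∏< b F
∏<-≡ F refl = ≈-refl

∏<-split : ∀ m j F → ∏< (m ℕ.+ j) F ≈ ∏< m F ⊗ ∏< j (λ i → F (m ℕ.+ i))
∏<-split m zero    F = ≈-trans (∏<-≡ F (ℕP.+-identityʳ m)) (≈-sym (⊗-identityʳ _))
∏<-split m (suc j) F = ≈-trans (∏<-≡ F (ℕP.+-suc m j)) (≈-trans (⊗-congˡ (F (m ℕ.+ j)) (∏<-split m j F))
  (⊗-assoc (∏< m F) (∏< j (λ i → F (m ℕ.+ i))) (F (m ℕ.+ j))))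

qint-≡ : ∀ b {m m′} → m ≡ m′ → qint b m ≈ qint b m′
qint-≡ b refl = ≈-refl

qfact-≡ : ∀ b {m m′} → m ≡ m′ → qfact b m ≈ qfact b m′
qfact-≡ b refl = ≈-refl

qint-+ : ∀ b a c → qint b (a ℕ.+ c) ≈ qint b a ⊕ X^ (b ℕ.* a) ⊗ qint b c
qint-+ b a zero = ≈-trans (qint-≡ b (ℕP.+-identityʳ a))
  (≈-sym (≈-trans (⊕-cong (≈-refl {qint b a}) (⊗-zeroʳ (X^ (b ℕ.* a)))) (⊕-identityʳ (qint b a))))
qint-+ b a (suc c) = begin
  qint b (a ℕ.+ suc c)
    ≈⟨ qint-≡ b (ℕP.+-suc a c) ⟩
  qint b (a ℕ.+ c) ⊕ X^ (b ℕ.* (a ℕ.+ c))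
    ≈⟨ ⊕-cong (qint-+ b a c) (≈-trans (X^-≡ (ℕP.*-distribˡ-+ b a c)) (≈-sym (X^-+ (b ℕ.* a) (b ℕ.* c)))) ⟩
  qint b a ⊕ X^ (b ℕ.* a) ⊗ qint b c ⊕ X^ (b ℕ.* a) ⊗ X^ (b ℕ.* c)
    ≈⟨ solve 4 (λ x y z w → (x :+ y :* z :+ y :* w) := (x :+ y :* (z :+ w))) ≈-refl
         (qint b a) (X^ (b ℕ.* a)) (qint b c) (X^ (b ℕ.* c)) ⟩
  qint b a ⊕ X^ (b ℕ.* a) ⊗ qint b (suc c) ∎
  where open ≈-Reasoning

ConstOne-qint : ∀ b m → ConstOne (qint (suc b) (suc m))
ConstOne-qint b zero    = Eq.trans (ℤP.+-identityˡ _) (cong (λ k → X^ k 0) (ℕP.*-zeroʳ (suc b)))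
ConstOne-qint b (suc m) = Eq.trans (ℤP.+-identityʳ _) (ConstOne-qint b m)

ConstOne-qfact : ∀ b m → ConstOne (qfact (suc b) m)
ConstOne-qfact b zero    = refl
ConstOne-qfact b (suc m) =
  ConstOne-⊗ {qfact (suc b) m} {qint (suc b) (suc m)} (ConstOne-qfact b m) (ConstOne-qint b m)

ConstOne-qfact² : ∀ b j m → ConstOne (qfact (suc b) j ⊗ qfact (suc b) m)
ConstOne-qfact² b j m = ConstOne-⊗ {qfact (suc b) j} {qfact (suc b) m} (ConstOne-qfact b j) (ConstOne-qfact b m)

[1-X^]⊗qint : ∀ b m → (𝟙 ⊖ X^ b) ⊗ qint b m ≈ 𝟙 ⊖ X^ (b ℕ.* m)
[1-X^]⊗qint b zero = ≈-trans (⊗-zeroʳ (𝟙 ⊖ X^ b))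
  (λ n → Eq.sym (Eq.trans (cong (λ z → 𝟙 n - z) (≈-trans (X^-≡ (ℕP.*-zeroʳ b)) X^0≈𝟙 n)) (ℤP.+-inverseʳ (𝟙 n))))
[1-X^]⊗qint b (suc m) = begin
  (𝟙 ⊖ X^ b) ⊗ (qint b m ⊕ X^ (b ℕ.* m))
    ≈⟨ ⊗-distribˡ (𝟙 ⊖ X^ b) (qint b m) (X^ (b ℕ.* m)) ⟩
  (𝟙 ⊖ X^ b) ⊗ qint b m ⊕ (𝟙 ⊖ X^ b) ⊗ X^ (b ℕ.* m)
    ≈⟨ ⊕-cong ([1-X^]⊗qint b m) ≈-refl ⟩
  𝟙 ⊖ X^ (b ℕ.* m) ⊕ (𝟙 ⊖ X^ b) ⊗ X^ (b ℕ.* m)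
    ≈⟨ solve 3 (λ o x y → (o :- y :+ (o :- x) :* y) := (o :- x :* y :+ (o :* y :- y))) ≈-refl 𝟙 (X^ b) (X^ (b ℕ.* m)) ⟩
  𝟙 ⊖ X^ b ⊗ X^ (b ℕ.* m) ⊕ (𝟙 ⊗ X^ (b ℕ.* m) ⊖ X^ (b ℕ.* m))
    ≈⟨ ⊕-cong (⊖-cong (≈-refl {𝟙}) (≈-trans (X^-+ b (b ℕ.* m)) (X^-≡ (Eq.sym (ℕP.*-suc b m)))))
              (λ n → Eq.trans (cong (_- X^ (b ℕ.* m) n) (⊗-identityˡ (X^ (b ℕ.* m)) n)) (ℤP.+-inverseʳ (X^ (b ℕ.* m) n))) ⟩
  𝟙 ⊖ X^ (b ℕ.* suc m) ⊕ 𝟘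
    ≈⟨ ⊕-identityʳ _ ⟩
  𝟙 ⊖ X^ (b ℕ.* suc m) ∎
  where open ≈-Reasoning

-- Gaussian binomial coefficients

⊕⊗𝟘 : ∀ f x → f ⊕ x ⊗ 𝟘 ≈ f
⊕⊗𝟘 f x = ≈-trans (⊕-cong (≈-refl {f}) (⊗-zeroʳ x)) (⊕-identityʳ f)

⊖⊗𝟘 : ∀ f x → f ⊖ x ⊗ 𝟘 ≈ f
⊖⊗𝟘 f x n = Eq.trans (cong (λ z → f n - z) (⊗-zeroʳ x n)) (ℤP.+-identityʳ (f n))

gauss : ℕ → ℕ → ℕ → FPS
gauss b zero    zero    = 𝟙
gauss b zero    (suc j) = 𝟘
gauss b (suc N) zero    = 𝟙
gauss b (suc N) (suc j) = gauss b N j ⊕ X^ (b ℕ.* suc j) ⊗ gauss b N (suc j)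

gauss-pred : ℕ → ℕ → ℕ → FPS
gauss-pred b N zero    = 𝟘
gauss-pred b N (suc j) = gauss b N j

gauss-≡ : ∀ b {N N′} j → N ≡ N′ → gauss b N j ≈ gauss b N′ j
gauss-≡ b j refl = ≈-refl

gauss-≡ʲ : ∀ b N {j j′} → j ≡ j′ → gauss b N j ≈ gauss b N j′
gauss-≡ʲ b N refl = ≈-refl

gauss-pred-≡ : ∀ b {N N′} j → N ≡ N′ → gauss-pred b N j ≈ gauss-pred b N′ j
gauss-pred-≡ b j refl = ≈-refl

gauss-0 : ∀ b N → gauss b N 0 ≈ 𝟙
gauss-0 b zero    = ≈-refl
gauss-0 b (suc N) = ≈-refl

gauss-above : ∀ b N j → N ℕ.< j → gauss b N j ≈ 𝟘
gauss-above b zero    (suc j) _       = ≈-refl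
gauss-above b (suc N) (suc j) (s≤s p) = ≈-trans
  (⊕-cong (gauss-above b N j p) (⊗-congʳ (X^ (b ℕ.* suc j)) (gauss-above b N (suc j) (ℕP.m<n⇒m<1+n p))))
  (⊕⊗𝟘 𝟘 (X^ (b ℕ.* suc j)))

gauss-diag : ∀ b N → gauss b N N ≈ 𝟙
gauss-diag b zero    = ≈-refl
gauss-diag b (suc N) = ≈-trans
  (⊕-cong (gauss-diag b N) (⊗-congʳ (X^ (b ℕ.* suc N)) (gauss-above b N (suc N) ℕP.≤-refl)))
  (⊕⊗𝟘 𝟙 (X^ (b ℕ.* suc N)))

gauss⊗qfacts : ∀ b j m → gauss b (j ℕ.+ m) j ⊗ (qfact b j ⊗ qfact b m) ≈ qfact b (j ℕ.+ m)
gauss⊗qfacts b zero    m    = ≈-trans (⊗-congˡ _ (gauss-0 b m)) (≈-trans (⊗-identityˡ _) (⊗-identityˡ _))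
gauss⊗qfacts b (suc j) zero = begin
  gauss b (suc j ℕ.+ 0) (suc j) ⊗ (qfact b (suc j) ⊗ 𝟙)
    ≈⟨ ⊗-cong (≈-trans (gauss-≡ b (suc j) (ℕP.+-identityʳ (suc j))) (gauss-diag b (suc j))) (⊗-identityʳ (qfact b (suc j))) ⟩
  𝟙 ⊗ qfact b (suc j)
    ≈⟨ ≈-trans (⊗-identityˡ _) (qfact-≡ b (Eq.sym (ℕP.+-identityʳ (suc j)))) ⟩
  qfact b (suc j ℕ.+ 0) ∎
  where open ≈-Reasoning
gauss⊗qfacts b (suc j) (suc m) = begin
  (A ⊕ x ⊗ B) ⊗ ((fj ⊗ qj) ⊗ (fm ⊗ qm))
    ≈⟨ solve 7 (λ A x B fj qj fm qm → ((A :+ x :* B) :* ((fj :* qj) :* (fm :* qm)))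
                    := (qj :* (A :* (fj :* (fm :* qm))) :+ x :* qm :* (B :* ((fj :* qj) :* fm))))
               ≈-refl A x B fj qj fm qm ⟩
  qj ⊗ (A ⊗ (fj ⊗ (fm ⊗ qm))) ⊕ x ⊗ qm ⊗ (B ⊗ ((fj ⊗ qj) ⊗ fm))
    ≈⟨ ⊕-cong (⊗-congʳ qj (gauss⊗qfacts b j (suc m))) (⊗-congʳ (x ⊗ qm) B-case) ⟩
  qj ⊗ F ⊕ x ⊗ qm ⊗ F
    ≈⟨ solve 4 (λ qj F x qm → (qj :* F :+ x :* qm :* F) := (F :* (qj :+ x :* qm))) ≈-refl qj F x qm ⟩
  F ⊗ (qj ⊕ x ⊗ qm)
    ≈⟨ ⊗-congʳ F (≈-sym (qint-+ b (suc j) (suc m))) ⟩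
  F ⊗ qint b (suc j ℕ.+ suc m) ∎
  where
  open ≈-Reasoning
  A = gauss b (j ℕ.+ suc m) j
  B = gauss b (j ℕ.+ suc m) (suc j)
  x = X^ (b ℕ.* suc j)
  fj = qfact b j
  fm = qfact b m
  qj = qint b (suc j)
  qm = qint b (suc m)
  F = qfact b (j ℕ.+ suc m)
  B-case : B ⊗ ((fj ⊗ qj) ⊗ fm) ≈ F
  B-case = ≈-trans (⊗-congˡ _ (gauss-≡ b (suc j) (ℕP.+-suc j m)))
                   (≈-trans (gauss⊗qfacts b (suc j) m) (qfact-≡ b (Eq.sym (ℕP.+-suc j m))))

qbinom≈gauss : ∀ b j m → qbinom (suc b) (j ℕ.+ m) j ≈ gauss (suc b) (j ℕ.+ m) j
qbinom≈gauss b j m rewrite ℕP.m+n∸m≡n j m =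
  ⊗-inv-exact _ _ _ (ConstOne-qfact² b j m) (gauss⊗qfacts (suc b) j m)

gauss-sym : ∀ b j m → gauss (suc b) (j ℕ.+ m) j ≈ gauss (suc b) (m ℕ.+ j) m
gauss-sym b j m = ⊗-cancelʳ _ _ (qfact (suc b) j ⊗ qfact (suc b) m) (ConstOne-qfact² b j m) (begin
  gauss (suc b) (j ℕ.+ m) j ⊗ (qfact (suc b) j ⊗ qfact (suc b) m)
    ≈⟨ gauss⊗qfacts (suc b) j m ⟩
  qfact (suc b) (j ℕ.+ m)
    ≈⟨ qfact-≡ (suc b) (ℕP.+-comm j m) ⟩
  qfact (suc b) (m ℕ.+ j)
    ≈⟨ ≈-sym (gauss⊗qfacts (suc b) m j) ⟩
  gauss (suc b) (m ℕ.+ j) m ⊗ (qfact (suc b) m ⊗ qfact (suc b) j)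
    ≈⟨ ⊗-congʳ (gauss (suc b) (m ℕ.+ j) m) (⊗-comm (qfact (suc b) m) (qfact (suc b) j)) ⟩
  gauss (suc b) (m ℕ.+ j) m ⊗ (qfact (suc b) j ⊗ qfact (suc b) m) ∎)
  where open ≈-Reasoning

-- The dual q-Pascal rule, obtained from the defining one through the symmetry j ↔ N − j.
gauss-pascal′-+ : ∀ b k m → gauss (suc b) (suc (k ℕ.+ m)) (suc k)
                            ≈ X^ (suc b ℕ.* m) ⊗ gauss (suc b) (k ℕ.+ m) k ⊕ gauss (suc b) (k ℕ.+ m) (suc k)
gauss-pascal′-+ b k zero = begin
  gauss (suc b) (suc (k ℕ.+ 0)) (suc k)
    ≈⟨ ≈-trans (gauss-≡ (suc b) (suc k) (cong suc (ℕP.+-identityʳ k))) (gauss-diag (suc b) (suc k)) ⟩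
  𝟙
    ≈⟨ ≈-sym (≈-trans (⊕-cong (⊗-cong (X^-≡ (ℕP.*-zeroʳ (suc b)))
                                       (≈-trans (gauss-≡ (suc b) k (ℕP.+-identityʳ k)) (gauss-diag (suc b) k)))
                               (≈-trans (gauss-≡ (suc b) (suc k) (ℕP.+-identityʳ k)) (gauss-above (suc b) k (suc k) ℕP.≤-refl)))
              (≈-trans (⊕-identityʳ _) (≈-trans (⊗-identityʳ _) X^0≈𝟙))) ⟩
  X^ (suc b ℕ.* 0) ⊗ gauss (suc b) (k ℕ.+ 0) k ⊕ gauss (suc b) (k ℕ.+ 0) (suc k) ∎
  where open ≈-Reasoning
gauss-pascal′-+ b k (suc m) = begin
  gauss (suc b) (suc (k ℕ.+ suc m)) (suc k)
    ≈⟨ ≈-sym (gauss-sym b (suc m) (suc k)) ⟩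
  gauss (suc b) (suc m ℕ.+ suc k) (suc m)
    ≈⟨ ⊕-cong (≈-trans (gauss-sym b m (suc k)) (gauss-≡ (suc b) (suc k) (Eq.sym (ℕP.+-suc k m))))
              (⊗-congʳ (X^ (suc b ℕ.* suc m))
                 (≈-trans (gauss-≡ (suc b) (suc m) (ℕP.+-suc m k)) (gauss-sym b (suc m) k))) ⟩
  gauss (suc b) (k ℕ.+ suc m) (suc k) ⊕ X^ (suc b ℕ.* suc m) ⊗ gauss (suc b) (k ℕ.+ suc m) k
    ≈⟨ (λ n → ℤP.+-comm (gauss (suc b) (k ℕ.+ suc m) (suc k) n) _) ⟩
  X^ (suc b ℕ.* suc m) ⊗ gauss (suc b) (k ℕ.+ suc m) k ⊕ gauss (suc b) (k ℕ.+ suc m) (suc k) ∎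
  where open ≈-Reasoning

gauss-pascal′ : ∀ b N k → gauss (suc b) (suc N) (suc k)
                          ≈ X^ (suc b ℕ.* (N ∸ k)) ⊗ gauss (suc b) N k ⊕ gauss (suc b) N (suc k)
gauss-pascal′ b N k with k ℕ.≤? N
... | yes k≤N = ≈-trans (gauss-≡ (suc b) (suc k) (cong suc (Eq.sym k+[N-k]≡N)))
                (≈-trans (gauss-pascal′-+ b k (N ∸ k))
                (⊕-cong (⊗-congʳ (X^ (suc b ℕ.* (N ∸ k))) (gauss-≡ (suc b) k k+[N-k]≡N))
                        (gauss-≡ (suc b) (suc k) k+[N-k]≡N)))
  where k+[N-k]≡N = ℕP.m+[n∸m]≡n k≤N
... | no k≰N = ≈-trans (gauss-above (suc b) (suc N) (suc k) (s≤s N<k)) (≈-sym (≈-trans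
                (⊕-cong (⊗-congʳ (X^ (suc b ℕ.* (N ∸ k))) (gauss-above (suc b) N k N<k))
                        (gauss-above (suc b) N (suc k) (ℕP.m<n⇒m<1+n N<k)))
                (≈-trans (⊕-identityʳ _) (⊗-zeroʳ (X^ (suc b ℕ.* (N ∸ k)))))))
  where N<k = ℕP.≰⇒> k≰N

qint⊗gauss : ∀ b j m → qint (suc b) (suc m) ⊗ gauss (suc b) (j ℕ.+ suc m) j
                       ≈ qint (suc b) (suc j) ⊗ gauss (suc b) (suc j ℕ.+ m) (suc j)
qint⊗gauss b j m = ⊗-cancelʳ _ _ (fj ⊗ fm) (ConstOne-qfact² b j m) (begin
  qm ⊗ gauss (suc b) (j ℕ.+ suc m) j ⊗ (fj ⊗ fm)
    ≈⟨ solve 4 (λ qm G fj fm → (qm :* G :* (fj :* fm)) := (G :* (fj :* (fm :* qm)))) ≈-refl qm (gauss (suc b) (j ℕ.+ suc m) j) fj fm ⟩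
  gauss (suc b) (j ℕ.+ suc m) j ⊗ (fj ⊗ (fm ⊗ qm))
    ≈⟨ gauss⊗qfacts (suc b) j (suc m) ⟩
  qfact (suc b) (j ℕ.+ suc m)
    ≈⟨ qfact-≡ (suc b) (ℕP.+-suc j m) ⟩
  qfact (suc b) (suc j ℕ.+ m)
    ≈⟨ ≈-sym (gauss⊗qfacts (suc b) (suc j) m) ⟩
  gauss (suc b) (suc j ℕ.+ m) (suc j) ⊗ ((fj ⊗ qj) ⊗ fm)
    ≈⟨ solve 4 (λ qj G fj fm → (G :* ((fj :* qj) :* fm)) := (qj :* G :* (fj :* fm))) ≈-refl qj (gauss (suc b) (suc j ℕ.+ m) (suc j)) fj fm ⟩
  qj ⊗ gauss (suc b) (suc j ℕ.+ m) (suc j) ⊗ (fj ⊗ fm) ∎)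
  where
  open ≈-Reasoning
  fj = qfact (suc b) j
  fm = qfact (suc b) m
  qj = qint (suc b) (suc j)
  qm = qint (suc b) (suc m)

qint⊗gauss-difference : ∀ b j r → let N = (j ℕ.+ r) ℕ.+ j in
  (gauss (suc b) N j ⊖ X^ (suc b ℕ.* suc r) ⊗ gauss-pred (suc b) N j) ⊗ qint (suc b) (suc (j ℕ.+ r))
  ≈ qint (suc b) (suc r) ⊗ gauss (suc b) N j
qint⊗gauss-difference b zero r =
  ≈-trans (⊗-congˡ (qint (suc b) (suc r)) (⊖⊗𝟘 (gauss (suc b) (r ℕ.+ 0) 0) (X^ (suc b ℕ.* suc r))))
          (⊗-comm (gauss (suc b) (r ℕ.+ 0) 0) (qint (suc b) (suc r)))
qint⊗gauss-difference b (suc j) r = begin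
  (G ⊖ x ⊗ G⁻) ⊗ Qt
    ≈⟨ solve 4 (λ G x G⁻ Qt → ((G :- x :* G⁻) :* Qt) := (G :* Qt :- x :* (Qt :* G⁻))) ≈-refl G x G⁻ Qt ⟩
  G ⊗ Qt ⊖ x ⊗ (Qt ⊗ G⁻)
    ≈⟨ ⊖-cong (⊗-congʳ G (≈-trans (qint-≡ (suc b) (idx₁ j r)) (qint-+ (suc b) (suc r) (suc j))))
              (⊗-congʳ x Qt⊗G⁻) ⟩
  G ⊗ (Qr ⊕ x ⊗ Qj) ⊖ x ⊗ (Qj ⊗ G)
    ≈⟨ solve 4 (λ G Qr x Qj → (G :* (Qr :+ x :* Qj) :- x :* (Qj :* G)) := (Qr :* G)) ≈-refl G Qr x Qj ⟩
  Qr ⊗ G ∎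
  where
  open ≈-Reasoning
  N = (suc j ℕ.+ r) ℕ.+ suc j
  G = gauss (suc b) N (suc j)
  G⁻ = gauss (suc b) N j
  x = X^ (suc b ℕ.* suc r)
  Qt = qint (suc b) (suc (suc j ℕ.+ r))
  Qr = qint (suc b) (suc r)
  Qj = qint (suc b) (suc j)
  idx₁ : ∀ j r → suc (suc j ℕ.+ r) ≡ suc r ℕ.+ suc j
  idx₁ = solve-∀
  idx₂ : ∀ j r → j ℕ.+ suc (suc j ℕ.+ r) ≡ (suc j ℕ.+ r) ℕ.+ suc j
  idx₂ = solve-∀
  idx₃ : ∀ j r → suc j ℕ.+ (suc j ℕ.+ r) ≡ (suc j ℕ.+ r) ℕ.+ suc j
  idx₃ = solve-∀
  Qt⊗G⁻ : Qt ⊗ G⁻ ≈ Qj ⊗ G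
  Qt⊗G⁻ = ≈-trans (⊗-congʳ Qt (gauss-≡ (suc b) j (Eq.sym (idx₂ j r))))
          (≈-trans (qint⊗gauss b j (suc j ℕ.+ r)) (⊗-congʳ Qj (gauss-≡ (suc b) (suc j) (idx₃ j r))))

Yam≈gauss-difference : ∀ b j r → let N = (j ℕ.+ r) ℕ.+ j in
  Yam (suc b) (j ℕ.+ r) j ≈ gauss (suc b) N j ⊖ X^ (suc b ℕ.* suc r) ⊗ gauss-pred (suc b) N j
Yam≈gauss-difference b j r rewrite ℕP.m+n∸m≡n j r = begin
  Qr ⊗ inv Qt ⊗ qbinom (suc b) N (j ℕ.+ r)
    ≈⟨ ⊗-congʳ (Qr ⊗ inv Qt) (≈-trans (qbinom≈gauss b (j ℕ.+ r) j)
         (≈-trans (gauss-sym b (j ℕ.+ r) j) (gauss-≡ (suc b) j (ℕP.+-comm j (j ℕ.+ r))))) ⟩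
  Qr ⊗ inv Qt ⊗ G
    ≈⟨ solve 3 (λ a b c → (a :* b :* c) := (a :* c :* b)) ≈-refl Qr (inv Qt) G ⟩
  Qr ⊗ G ⊗ inv Qt
    ≈⟨ ⊗-inv-exact _ Qt (Qr ⊗ G) (ConstOne-qint b (j ℕ.+ r)) (qint⊗gauss-difference b j r) ⟩
  G ⊖ X^ (suc b ℕ.* suc r) ⊗ gauss-pred (suc b) N j ∎
  where
  open ≈-Reasoning
  N = (j ℕ.+ r) ℕ.+ j
  G = gauss (suc b) N j
  Qr = qint (suc b) (suc r)
  Qt = qint (suc b) (suc (j ℕ.+ r))

-- The sums Σₖ q^{ck} [N k]_{q²} for c = 1, 3

minusqPoch : ℕ → FPS
minusqPoch N = poch (- (+ 1)) 1 1 N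

minusqPoch-suc : ∀ N → minusqPoch (suc N) ≈ minusqPoch N ⊗ (𝟙 ⊕ X^ (suc N))
minusqPoch-suc N = ⊗-congʳ (minusqPoch N) λ n →
  Eq.trans (cong (λ z → 𝟙 n - z) (ℤP.-1*i≡-i _)) (Eq.trans (cong (λ z → 𝟙 n + z) (ℤP.neg-involutive _))
           (cong (λ e → 𝟙 n + X^ (suc e) n) (ℕP.+-identityʳ N)))

gaussSum : ℕ → ℕ → FPS
gaussSum c N = Σ< (suc N) (λ k → X^ (c ℕ.* k) ⊗ gauss 2 N k)

X^[c*0]⊗𝟙 : ∀ c → X^ (c ℕ.* 0) ⊗ 𝟙 ≈ 𝟙
X^[c*0]⊗𝟙 c = ≈-trans (⊗-identityʳ _) (≈-trans (X^-≡ (ℕP.*-zeroʳ c)) X^0≈𝟙)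

gaussSum-suc : ∀ c N → gaussSum c (suc N) ≈ X^ c ⊗ gaussSum c N ⊕ gaussSum (c ℕ.+ 2) N
gaussSum-suc c N = begin
  gaussSum c (suc N)
    ≈⟨ Σ<-suc (suc N) _ ⟩
  X^ (c ℕ.* 0) ⊗ 𝟙 ⊕ Σ< (suc N) (λ k → X^ (c ℕ.* suc k) ⊗ gauss 2 (suc N) (suc k))
    ≈⟨ ⊕-cong (X^[c*0]⊗𝟙 c) (≈-trans (Σ<-cong (suc N) (λ k _ → pascal-term k)) (Σ<-⊕ (suc N) _ _)) ⟩
  𝟙 ⊕ (Σ< (suc N) (λ k → X^ c ⊗ (X^ (c ℕ.* k) ⊗ gauss 2 N k)) ⊕ (Σ< N (W ∘ suc) ⊕ W (suc N)))
    ≈⟨ ⊕-cong (≈-refl {𝟙}) (⊕-cong (≈-sym (⊗-Σ< (suc N) (X^ c) (λ k → X^ (c ℕ.* k) ⊗ gauss 2 N k)))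
                                   (⊕-cong (≈-refl {Σ< N (W ∘ suc)}) last-term)) ⟩
  𝟙 ⊕ (X^ c ⊗ gaussSum c N ⊕ (Σ< N (W ∘ suc) ⊕ 𝟘))
    ≈⟨ ⊕-cong (≈-refl {𝟙}) (⊕-cong (≈-refl {X^ c ⊗ gaussSum c N}) (⊕-identityʳ _)) ⟩
  𝟙 ⊕ (X^ c ⊗ gaussSum c N ⊕ Σ< N (W ∘ suc))
    ≈⟨ solve 3 (λ a b c → (a :+ (b :+ c)) := (b :+ (a :+ c))) ≈-refl 𝟙 (X^ c ⊗ gaussSum c N) (Σ< N (W ∘ suc)) ⟩
  X^ c ⊗ gaussSum c N ⊕ (𝟙 ⊕ Σ< N (W ∘ suc))
    ≈⟨ ⊕-cong (≈-refl {X^ c ⊗ gaussSum c N}) (≈-trans (⊕-cong first-term (≈-refl {Σ< N (W ∘ suc)})) (≈-sym (Σ<-suc N W))) ⟩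
  X^ c ⊗ gaussSum c N ⊕ gaussSum (c ℕ.+ 2) N ∎
  where
  open ≈-Reasoning
  W : ℕ → FPS
  W k = X^ ((c ℕ.+ 2) ℕ.* k) ⊗ gauss 2 N k
  first-term : 𝟙 ≈ W 0
  first-term = ≈-sym (≈-trans (⊗-congʳ (X^ ((c ℕ.+ 2) ℕ.* 0)) (gauss-0 2 N)) (X^[c*0]⊗𝟙 (c ℕ.+ 2)))
  last-term : W (suc N) ≈ 𝟘
  last-term = ≈-trans (⊗-congʳ (X^ ((c ℕ.+ 2) ℕ.* suc N)) (gauss-above 2 N (suc N) ℕP.≤-refl)) (⊗-zeroʳ (X^ ((c ℕ.+ 2) ℕ.* suc N)))
  pascal-term : ∀ k → X^ (c ℕ.* suc k) ⊗ gauss 2 (suc N) (suc k) ≈ X^ c ⊗ (X^ (c ℕ.* k) ⊗ gauss 2 N k) ⊕ W (suc k)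
  pascal-term k = begin
    X^ (c ℕ.* suc k) ⊗ (gauss 2 N k ⊕ X^ (2 ℕ.* suc k) ⊗ gauss 2 N (suc k))
      ≈⟨ ⊗-distribˡ (X^ (c ℕ.* suc k)) (gauss 2 N k) (X^ (2 ℕ.* suc k) ⊗ gauss 2 N (suc k)) ⟩
    X^ (c ℕ.* suc k) ⊗ gauss 2 N k ⊕ X^ (c ℕ.* suc k) ⊗ (X^ (2 ℕ.* suc k) ⊗ gauss 2 N (suc k))
      ≈⟨ ⊕-cong (≈-trans (⊗-congˡ (gauss 2 N k) (≈-trans (X^-≡ (ℕP.*-suc c k)) (≈-sym (X^-+ c (c ℕ.* k)))))
                         (⊗-assoc (X^ c) (X^ (c ℕ.* k)) (gauss 2 N k)))
                (≈-trans (≈-sym (⊗-assoc (X^ (c ℕ.* suc k)) (X^ (2 ℕ.* suc k)) (gauss 2 N (suc k))))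
                         (⊗-congˡ (gauss 2 N (suc k)) (≈-trans (X^-+ (c ℕ.* suc k) (2 ℕ.* suc k))
                                                               (X^-≡ (Eq.sym (ℕP.*-distribʳ-+ (suc k) c 2)))))) ⟩
    X^ c ⊗ (X^ (c ℕ.* k) ⊗ gauss 2 N k) ⊕ W (suc k) ∎

gaussSum3-suc : ∀ N → gaussSum 3 (suc N) ≈ gaussSum 3 N ⊕ X^ (2 ℕ.* N ℕ.+ 3) ⊗ gaussSum 1 N
gaussSum3-suc N = begin
  gaussSum 3 (suc N)
    ≈⟨ Σ<-suc (suc N) _ ⟩
  X^ (3 ℕ.* 0) ⊗ 𝟙 ⊕ Σ< (suc N) (λ k → X^ (3 ℕ.* suc k) ⊗ gauss 2 (suc N) (suc k))
    ≈⟨ ⊕-cong first-term (≈-trans (Σ<-cong (suc N) (λ k k<1+N → pascal-term k (ℕP.≤-pred k<1+N))) (Σ<-⊕ (suc N) _ _)) ⟩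
  W 0 ⊕ (Σ< (suc N) (λ k → X^ e ⊗ (X^ (1 ℕ.* k) ⊗ gauss 2 N k)) ⊕ (Σ< N (W ∘ suc) ⊕ W (suc N)))
    ≈⟨ ⊕-cong (≈-refl {W 0}) (⊕-cong (≈-sym (⊗-Σ< (suc N) (X^ e) (λ k → X^ (1 ℕ.* k) ⊗ gauss 2 N k)))
                                     (≈-trans (⊕-cong (≈-refl {Σ< N (W ∘ suc)}) last-term) (⊕-identityʳ _))) ⟩
  W 0 ⊕ (X^ e ⊗ gaussSum 1 N ⊕ Σ< N (W ∘ suc))
    ≈⟨ solve 3 (λ a b c → (a :+ (b :+ c)) := ((a :+ c) :+ b)) ≈-refl (W 0) (X^ e ⊗ gaussSum 1 N) (Σ< N (W ∘ suc)) ⟩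
  W 0 ⊕ Σ< N (W ∘ suc) ⊕ X^ e ⊗ gaussSum 1 N
    ≈⟨ ⊕-cong (≈-sym (Σ<-suc N W)) (≈-refl {X^ e ⊗ gaussSum 1 N}) ⟩
  gaussSum 3 N ⊕ X^ e ⊗ gaussSum 1 N ∎
  where
  open ≈-Reasoning
  e = 2 ℕ.* N ℕ.+ 3
  W : ℕ → FPS
  W k = X^ (3 ℕ.* k) ⊗ gauss 2 N k
  first-term : X^ (3 ℕ.* 0) ⊗ 𝟙 ≈ W 0
  first-term = ≈-trans (X^[c*0]⊗𝟙 3) (≈-sym (≈-trans (⊗-congʳ (X^ (3 ℕ.* 0)) (gauss-0 2 N)) (X^[c*0]⊗𝟙 3)))
  last-term : W (suc N) ≈ 𝟘
  last-term = ≈-trans (⊗-congʳ (X^ (3 ℕ.* suc N)) (gauss-above 2 N (suc N) ℕP.≤-refl)) (⊗-zeroʳ (X^ (3 ℕ.* suc N)))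
  exponents : ∀ k d → 3 ℕ.* suc k ℕ.+ 2 ℕ.* d ≡ (2 ℕ.* (k ℕ.+ d) ℕ.+ 3) ℕ.+ 1 ℕ.* k
  exponents = solve-∀
  pascal-term : ∀ k → k ℕ.≤ N → X^ (3 ℕ.* suc k) ⊗ gauss 2 (suc N) (suc k) ≈ X^ e ⊗ (X^ (1 ℕ.* k) ⊗ gauss 2 N k) ⊕ W (suc k)
  pascal-term k k≤N = begin
    X^ (3 ℕ.* suc k) ⊗ gauss 2 (suc N) (suc k)
      ≈⟨ ⊗-congʳ (X^ (3 ℕ.* suc k)) (gauss-pascal′ 1 N k) ⟩
    X^ (3 ℕ.* suc k) ⊗ (X^ (2 ℕ.* (N ∸ k)) ⊗ gauss 2 N k ⊕ gauss 2 N (suc k))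
      ≈⟨ ⊗-distribˡ (X^ (3 ℕ.* suc k)) (X^ (2 ℕ.* (N ∸ k)) ⊗ gauss 2 N k) (gauss 2 N (suc k)) ⟩
    X^ (3 ℕ.* suc k) ⊗ (X^ (2 ℕ.* (N ∸ k)) ⊗ gauss 2 N k) ⊕ W (suc k)
      ≈⟨ ⊕-cong (X^-swap (3 ℕ.* suc k) (2 ℕ.* (N ∸ k)) e (1 ℕ.* k) (gauss 2 N k)
                   (Eq.trans (exponents k (N ∸ k)) (cong (λ z → (2 ℕ.* z ℕ.+ 3) ℕ.+ 1 ℕ.* k) (ℕP.m+[n∸m]≡n k≤N))))
                (≈-refl {W (suc k)}) ⟩
    X^ e ⊗ (X^ (1 ℕ.* k) ⊗ gauss 2 N k) ⊕ W (suc k) ∎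

gaussSum-closed : ∀ N → gaussSum 1 N ≈ minusqPoch N × gaussSum 3 N ≈ (𝟙 ⊖ X^ 1 ⊕ X^ (suc N)) ⊗ minusqPoch N
gaussSum-closed zero = gaussSum₀ 1 , ≈-trans (gaussSum₀ 3) (≈-sym (≈-trans (⊗-identityʳ (𝟙 ⊖ X^ 1 ⊕ X^ 1)) cancel))
  where
  gaussSum₀ : ∀ c → gaussSum c 0 ≈ 𝟙
  gaussSum₀ c n = Eq.trans (ℤP.+-identityˡ _) (X^[c*0]⊗𝟙 c n)
  cancel : 𝟙 ⊖ X^ 1 ⊕ X^ 1 ≈ 𝟙
  cancel n = Eq.trans (ℤP.+-assoc (𝟙 n) (- X^ 1 n) (X^ 1 n))
             (Eq.trans (cong (λ z → 𝟙 n + z) (ℤP.+-inverseˡ (X^ 1 n))) (ℤP.+-identityʳ _))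
gaussSum-closed (suc N) = sum₁ , sum₃
  where
  open ≈-Reasoning
  IH₁ = proj₁ (gaussSum-closed N)
  IH₃ = proj₂ (gaussSum-closed N)
  x = X^ 1
  y = X^ (suc N)
  p = minusqPoch N
  xy : X^ (suc (suc N)) ≈ x ⊗ y
  xy = ≈-sym (X^-+ 1 (suc N))
  xyy : X^ (2 ℕ.* N ℕ.+ 3) ≈ x ⊗ y ⊗ y
  xyy = ≈-trans (X^-≡ (exponent N)) (≈-trans (≈-sym (X^-+ (suc (suc N)) (suc N))) (⊗-congˡ y xy))
    where exponent : ∀ N → 2 ℕ.* N ℕ.+ 3 ≡ suc (suc N) ℕ.+ suc N
          exponent = solve-∀
  sum₁ : gaussSum 1 (suc N) ≈ minusqPoch (suc N)
  sum₁ = begin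
    gaussSum 1 (suc N)          ≈⟨ gaussSum-suc 1 N ⟩
    x ⊗ gaussSum 1 N ⊕ gaussSum 3 N ≈⟨ ⊕-cong (⊗-congʳ x IH₁) IH₃ ⟩
    x ⊗ p ⊕ (𝟙 ⊖ x ⊕ y) ⊗ p     ≈⟨ solve 4 (λ o x y p → (x :* p :+ (o :- x :+ y) :* p) := (p :* (o :+ y))) ≈-refl 𝟙 x y p ⟩
    p ⊗ (𝟙 ⊕ y)                ≈⟨ ≈-sym (minusqPoch-suc N) ⟩
    minusqPoch (suc N)         ∎
  sum₃ : gaussSum 3 (suc N) ≈ (𝟙 ⊖ x ⊕ X^ (suc (suc N))) ⊗ minusqPoch (suc N)
  sum₃ = begin
    gaussSum 3 (suc N)
      ≈⟨ gaussSum3-suc N ⟩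
    gaussSum 3 N ⊕ X^ (2 ℕ.* N ℕ.+ 3) ⊗ gaussSum 1 N
      ≈⟨ ⊕-cong (≈-trans IH₃ (⊗-congˡ p (⊕-cong (⊖-cong 𝟙≈con1 (≈-refl {x})) (≈-refl {y}))))
                (⊗-cong xyy IH₁) ⟩
    ((+ 1) · 𝟙 ⊖ x ⊕ y) ⊗ p ⊕ x ⊗ y ⊗ y ⊗ p
      ≈⟨ solve 3 (λ x y p → ((con (+ 1) :- x :+ y) :* p :+ x :* y :* y :* p)
                            := ((con (+ 1) :- x :+ x :* y) :* (p :* (con (+ 1) :+ y)))) ≈-refl x y p ⟩
    ((+ 1) · 𝟙 ⊖ x ⊕ x ⊗ y) ⊗ (p ⊗ ((+ 1) · 𝟙 ⊕ y))
      ≈⟨ ⊗-cong (⊕-cong (⊖-cong (≈-sym 𝟙≈con1) (≈-refl {x})) (≈-sym xy))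
                (≈-trans (⊗-congʳ p (⊕-cong (≈-sym 𝟙≈con1) (≈-refl {y}))) (≈-sym (minusqPoch-suc N))) ⟩
    (𝟙 ⊖ x ⊕ X^ (suc (suc N))) ⊗ minusqPoch (suc N) ∎

-- The finite identity Σₖ q^{3k} Y_{q²}(2n−k, k) [2(n−k)+1]_q = (−q;q)_{2n}

oneMinusq : FPS
oneMinusq = 𝟙 ⊖ X^ 1

oneMinusq⊗qint : ∀ m → oneMinusq ⊗ qint 1 m ≈ 𝟙 ⊖ X^ m
oneMinusq⊗qint m = ≈-trans ([1-X^]⊗qint 1 m) (⊖-cong (≈-refl {𝟙}) (X^-≡ (ℕP.*-identityˡ m)))

summand : ℕ → ℕ → FPS
summand n k = X^ (3 ℕ.* k) ⊗ Yam 2 (2 ℕ.* n ∸ k) k ⊗ qint 1 (suc (2 ℕ.* (n ∸ k)))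

summandSum : ℕ → FPS
summandSum n = Σ< (suc n) (summand n)

-- After multiplication by 1 − q, summand n k becomes A n k − B n (k − 1),
-- and B n j is −A n (2n − j) by the symmetry of [2n j]_{q²}.
A : ℕ → ℕ → FPS
A n k = (X^ (3 ℕ.* k) ⊖ X^ (2 ℕ.* n ℕ.+ 1 ℕ.+ k)) ⊗ gauss 2 (2 ℕ.* n) k

B : ℕ → ℕ → FPS
B n j = (X^ (2 ℕ.* n ℕ.+ 1 ℕ.+ (2 ℕ.* n ∸ j)) ⊖ X^ (3 ℕ.* (2 ℕ.* n ∸ j))) ⊗ gauss 2 (2 ℕ.* n) j

oneMinusq⊗summand : ∀ k d → oneMinusq ⊗ summand (k ℕ.+ d) k ≈
   (X^ (3 ℕ.* k) ⊖ X^ (2 ℕ.* (k ℕ.+ d) ℕ.+ 1 ℕ.+ k)) ⊗ gauss 2 (2 ℕ.* (k ℕ.+ d)) k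
   ⊖ (X^ (3 ℕ.* k ℕ.+ (4 ℕ.* d ℕ.+ 2)) ⊖ X^ (3 ℕ.* k ℕ.+ (6 ℕ.* d ℕ.+ 3))) ⊗ gauss-pred 2 (2 ℕ.* (k ℕ.+ d)) k
oneMinusq⊗summand k d rewrite ℕP.m+n∸m≡n k d = begin
  D ⊗ (X₃ ⊗ Yam 2 (2 ℕ.* (k ℕ.+ d) ∸ k) k ⊗ Q)
    ≈⟨ ⊗-congʳ D (⊗-congˡ Q (⊗-congʳ X₃ Yam≈)) ⟩
  D ⊗ (X₃ ⊗ (G ⊖ x ⊗ G⁻) ⊗ Q)
    ≈⟨ solve 6 (λ D X₃ G x G⁻ Q → (D :* (X₃ :* (G :- x :* G⁻) :* Q)) := ((X₃ :* G :- X₃ :* x :* G⁻) :* (D :* Q)))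
               ≈-refl D X₃ G x G⁻ Q ⟩
  (X₃ ⊗ G ⊖ X₃ ⊗ x ⊗ G⁻) ⊗ (D ⊗ Q)
    ≈⟨ ⊗-congʳ (X₃ ⊗ G ⊖ X₃ ⊗ x ⊗ G⁻) (oneMinusq⊗qint (suc (2 ℕ.* d))) ⟩
  (X₃ ⊗ G ⊖ X₃ ⊗ x ⊗ G⁻) ⊗ (𝟙 ⊖ z)
    ≈⟨ solve 6 (λ o X₃ G x G⁻ z → ((X₃ :* G :- X₃ :* x :* G⁻) :* (o :- z))
                                  := ((X₃ :* o :- X₃ :* z) :* G :- (X₃ :* x :* o :- X₃ :* x :* z) :* G⁻))
               ≈-refl 𝟙 X₃ G x G⁻ z ⟩
  (X₃ ⊗ 𝟙 ⊖ X₃ ⊗ z) ⊗ G ⊖ (X₃ ⊗ x ⊗ 𝟙 ⊖ X₃ ⊗ x ⊗ z) ⊗ G⁻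
    ≈⟨ ⊖-cong (⊗-congˡ G (⊖-cong (⊗-identityʳ X₃) (≈-trans (X^-+ (3 ℕ.* k) (suc (2 ℕ.* d))) (X^-≡ (e₁ k d)))))
              (⊗-congˡ G⁻ (⊖-cong (≈-trans (⊗-identityʳ (X₃ ⊗ x)) X₃x)
                                  (≈-trans (⊗-congˡ z X₃x) (≈-trans (X^-+ (3 ℕ.* k ℕ.+ (4 ℕ.* d ℕ.+ 2)) (suc (2 ℕ.* d))) (X^-≡ (e₂ k d)))))) ⟩
  (X₃ ⊖ X^ (2 ℕ.* (k ℕ.+ d) ℕ.+ 1 ℕ.+ k)) ⊗ G ⊖ (X^ (3 ℕ.* k ℕ.+ (4 ℕ.* d ℕ.+ 2)) ⊖ X^ (3 ℕ.* k ℕ.+ (6 ℕ.* d ℕ.+ 3))) ⊗ G⁻ ∎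
  where
  open ≈-Reasoning
  D = oneMinusq
  X₃ = X^ (3 ℕ.* k)
  G = gauss 2 (2 ℕ.* (k ℕ.+ d)) k
  G⁻ = gauss-pred 2 (2 ℕ.* (k ℕ.+ d)) k
  x = X^ (2 ℕ.* suc (2 ℕ.* d))
  z = X^ (suc (2 ℕ.* d))
  Q = qint 1 (suc (2 ℕ.* d))
  e₀ : ∀ k d → 2 ℕ.* (k ℕ.+ d) ≡ k ℕ.+ (k ℕ.+ 2 ℕ.* d)
  e₀ = solve-∀
  e₁ : ∀ k d → 3 ℕ.* k ℕ.+ suc (2 ℕ.* d) ≡ 2 ℕ.* (k ℕ.+ d) ℕ.+ 1 ℕ.+ k
  e₁ = solve-∀
  e₂ : ∀ k d → 3 ℕ.* k ℕ.+ (4 ℕ.* d ℕ.+ 2) ℕ.+ suc (2 ℕ.* d) ≡ 3 ℕ.* k ℕ.+ (6 ℕ.* d ℕ.+ 3)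
  e₂ = solve-∀
  e₃ : ∀ k d → 3 ℕ.* k ℕ.+ 2 ℕ.* suc (2 ℕ.* d) ≡ 3 ℕ.* k ℕ.+ (4 ℕ.* d ℕ.+ 2)
  e₃ = solve-∀
  e₄ : ∀ k d → (k ℕ.+ 2 ℕ.* d) ℕ.+ k ≡ 2 ℕ.* (k ℕ.+ d)
  e₄ = solve-∀
  X₃x : X₃ ⊗ x ≈ X^ (3 ℕ.* k ℕ.+ (4 ℕ.* d ℕ.+ 2))
  X₃x = ≈-trans (X^-+ (3 ℕ.* k) (2 ℕ.* suc (2 ℕ.* d))) (X^-≡ (e₃ k d))
  Yam≈ : Yam 2 (2 ℕ.* (k ℕ.+ d) ∸ k) k ≈ G ⊖ x ⊗ G⁻
  Yam≈ = ≈-trans (λ n → cong (λ m → Yam 2 m k n) (Eq.trans (cong (_∸ k) (e₀ k d)) (ℕP.m+n∸m≡n k _)))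
         (≈-trans (Yam≈gauss-difference 1 k (2 ℕ.* d))
                  (⊖-cong (gauss-≡ 2 k (e₄ k d)) (⊗-congʳ x (gauss-pred-≡ 2 k (e₄ k d)))))

oneMinusq⊗summand-0 : ∀ n → oneMinusq ⊗ summand n 0 ≈ A n 0
oneMinusq⊗summand-0 n = ≈-trans (oneMinusq⊗summand 0 n)
  (⊖⊗𝟘 (A n 0) (X^ (3 ℕ.* 0 ℕ.+ (4 ℕ.* n ℕ.+ 2)) ⊖ X^ (3 ℕ.* 0 ℕ.+ (6 ℕ.* n ℕ.+ 3))))

oneMinusq⊗summand-suc : ∀ n j → suc j ℕ.≤ n → oneMinusq ⊗ summand n (suc j) ≈ A n (suc j) ⊖ B n j
oneMinusq⊗summand-suc n j j<n =
  Eq.subst (λ m → oneMinusq ⊗ summand m (suc j) ≈ A m (suc j) ⊖ B m j) (ℕP.m+[n∸m]≡n j<n) (shifted (n ∸ suc j))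
  where
  shifted : ∀ d → oneMinusq ⊗ summand (suc j ℕ.+ d) (suc j) ≈ A (suc j ℕ.+ d) (suc j) ⊖ B (suc j ℕ.+ d) j
  shifted d = ≈-trans (oneMinusq⊗summand (suc j) d) (⊖-cong (≈-refl {A (suc j ℕ.+ d) (suc j)})
    (⊗-congˡ (gauss 2 (2 ℕ.* (suc j ℕ.+ d)) j)
      (⊖-cong (X^-≡ (Eq.trans (e₁ j d) (cong (λ z → 2 ℕ.* (suc j ℕ.+ d) ℕ.+ 1 ℕ.+ z) (Eq.sym 2n-j))))
              (X^-≡ (Eq.trans (e₂ j d) (cong (3 ℕ.*_) (Eq.sym 2n-j)))))))
    where
    e₀ : ∀ j d → 2 ℕ.* (suc j ℕ.+ d) ≡ j ℕ.+ (j ℕ.+ 2 ℕ.+ 2 ℕ.* d)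
    e₀ = solve-∀
    e₁ : ∀ j d → 3 ℕ.* suc j ℕ.+ (4 ℕ.* d ℕ.+ 2) ≡ 2 ℕ.* (suc j ℕ.+ d) ℕ.+ 1 ℕ.+ (j ℕ.+ 2 ℕ.+ 2 ℕ.* d)
    e₁ = solve-∀
    e₂ : ∀ j d → 3 ℕ.* suc j ℕ.+ (6 ℕ.* d ℕ.+ 3) ≡ 3 ℕ.* (j ℕ.+ 2 ℕ.+ 2 ℕ.* d)
    e₂ = solve-∀
    2n-j : 2 ℕ.* (suc j ℕ.+ d) ∸ j ≡ j ℕ.+ 2 ℕ.+ 2 ℕ.* d
    2n-j = Eq.trans (cong (_∸ j) (e₀ j d)) (ℕP.m+n∸m≡n j _)

A-reflect : ∀ n j → suc j ℕ.≤ n → A n (suc n ℕ.+ (n ∸ suc j)) ≈ neg (B n j)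
A-reflect n j j<n =
  Eq.subst (λ m → A m (suc m ℕ.+ (m ∸ suc j)) ≈ neg (B m j)) (ℕP.m+[n∸m]≡n j<n) (shifted (n ∸ suc j))
  where
  shifted : ∀ e → let m = suc j ℕ.+ e in A m (suc m ℕ.+ (m ∸ suc j)) ≈ neg (B m j)
  shifted e rewrite ℕP.m+n∸m≡n (suc j) e = begin
    (X^ (3 ℕ.* l) ⊖ X^ (2 ℕ.* m ℕ.+ 1 ℕ.+ l)) ⊗ gauss 2 (2 ℕ.* m) l
      ≈⟨ ⊗-cong (⊖-cong (X^-≡ (cong (3 ℕ.*_) l≡l′)) (X^-≡ (cong (2 ℕ.* m ℕ.+ 1 ℕ.+_) l≡l′))) symmetry ⟩
    (X^ (3 ℕ.* l′) ⊖ X^ (2 ℕ.* m ℕ.+ 1 ℕ.+ l′)) ⊗ gauss 2 (2 ℕ.* m) j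
      ≈⟨ solve 3 (λ a c G → ((a :- c) :* G) := (:- ((c :- a) :* G))) ≈-refl
           (X^ (3 ℕ.* l′)) (X^ (2 ℕ.* m ℕ.+ 1 ℕ.+ l′)) (gauss 2 (2 ℕ.* m) j) ⟩
    neg (B m j) ∎
    where
    open ≈-Reasoning
    m = suc j ℕ.+ e
    l = suc m ℕ.+ e
    l′ = 2 ℕ.* m ∸ j
    e₀ : ∀ j e → 2 ℕ.* (suc j ℕ.+ e) ≡ j ℕ.+ (suc (suc j ℕ.+ e) ℕ.+ e)
    e₀ = solve-∀
    l≡l′ : l ≡ l′
    l≡l′ = Eq.sym (Eq.trans (cong (_∸ j) (e₀ j e)) (ℕP.m+n∸m≡n j _))
    j≤2m : j ℕ.≤ 2 ℕ.* m
    j≤2m = ℕP.≤-trans (ℕP.≤-trans (ℕP.n≤1+n j) (ℕP.m≤m+n (suc j) e)) (ℕP.m≤m+n m (m ℕ.+ 0))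
    symmetry : gauss 2 (2 ℕ.* m) l ≈ gauss 2 (2 ℕ.* m) j
    symmetry = ≈-trans (gauss-≡ʲ 2 (2 ℕ.* m) l≡l′)
               (≈-trans (gauss-≡ 2 l′ (Eq.sym (ℕP.m∸n+n≡m j≤2m)))
               (≈-trans (gauss-sym 1 l′ j) (gauss-≡ 2 j (ℕP.m+[n∸m]≡n j≤2m))))

oneMinusq⊗summandSum : ∀ n → oneMinusq ⊗ summandSum n ≈ Σ< (suc n) (A n) ⊖ Σ< n (B n)
oneMinusq⊗summandSum n = begin
  oneMinusq ⊗ Σ< (suc n) (summand n)
    ≈⟨ ≈-trans (⊗-Σ< (suc n) oneMinusq (summand n)) (Σ<-suc n (λ k → oneMinusq ⊗ summand n k)) ⟩
  oneMinusq ⊗ summand n 0 ⊕ Σ< n (λ j → oneMinusq ⊗ summand n (suc j))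
    ≈⟨ ⊕-cong (oneMinusq⊗summand-0 n)
              (≈-trans (Σ<-cong n (oneMinusq⊗summand-suc n)) (Σ<-⊖ n (λ j → A n (suc j)) (B n))) ⟩
  A n 0 ⊕ (Σ< n (λ j → A n (suc j)) ⊖ Σ< n (B n))
    ≈⟨ solve 3 (λ a b c → (a :+ (b :- c)) := (a :+ b :- c)) ≈-refl (A n 0) (Σ< n (λ j → A n (suc j))) (Σ< n (B n)) ⟩
  A n 0 ⊕ Σ< n (λ j → A n (suc j)) ⊖ Σ< n (B n)
    ≈⟨ ⊖-cong (≈-sym (Σ<-suc n (A n))) (≈-refl {Σ< n (B n)}) ⟩
  Σ< (suc n) (A n) ⊖ Σ< n (B n) ∎
  where open ≈-Reasoning

gaussSum-difference : ∀ n → gaussSum 3 (2 ℕ.* n) ⊖ X^ (2 ℕ.* n ℕ.+ 1) ⊗ gaussSum 1 (2 ℕ.* n) ≈ Σ< (suc (2 ℕ.* n)) (A n)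
gaussSum-difference n = begin
  gaussSum 3 N ⊖ X^ e ⊗ gaussSum 1 N
    ≈⟨ ⊖-cong (≈-refl {gaussSum 3 N}) (⊗-Σ< (suc N) (X^ e) (λ k → X^ (1 ℕ.* k) ⊗ gauss 2 N k)) ⟩
  gaussSum 3 N ⊖ Σ< (suc N) (λ k → X^ e ⊗ (X^ (1 ℕ.* k) ⊗ gauss 2 N k))
    ≈⟨ ≈-sym (Σ<-⊖ (suc N) _ _) ⟩
  Σ< (suc N) (λ k → X^ (3 ℕ.* k) ⊗ gauss 2 N k ⊖ X^ e ⊗ (X^ (1 ℕ.* k) ⊗ gauss 2 N k))
    ≈⟨ Σ<-cong (suc N) (λ k _ → termwise k) ⟩
  Σ< (suc N) (A n) ∎
  where
  open ≈-Reasoning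
  N = 2 ℕ.* n
  e = 2 ℕ.* n ℕ.+ 1
  termwise : ∀ k → X^ (3 ℕ.* k) ⊗ gauss 2 N k ⊖ X^ e ⊗ (X^ (1 ℕ.* k) ⊗ gauss 2 N k) ≈ A n k
  termwise k = ≈-trans
    (solve 4 (λ a c b G → (a :* G :- c :* (b :* G)) := ((a :- c :* b) :* G)) ≈-refl (X^ (3 ℕ.* k)) (X^ e) (X^ (1 ℕ.* k)) (gauss 2 N k))
    (⊗-congˡ (gauss 2 N k) (⊖-cong (≈-refl {X^ (3 ℕ.* k)}) (≈-trans (X^-+ e (1 ℕ.* k)) (X^-≡ (cong (e ℕ.+_) (ℕP.*-identityˡ k))))))

Σ<-A : ∀ n → Σ< (suc (2 ℕ.* n)) (A n) ≈ Σ< (suc n) (A n) ⊖ Σ< n (B n)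
Σ<-A n = begin
  Σ< (suc (2 ℕ.* n)) (A n)
    ≈⟨ Σ<-≡ (A n) (2n+1≡ n) ⟩
  Σ< (suc n ℕ.+ n) (A n)
    ≈⟨ Σ<-split (suc n) n (A n) ⟩
  Σ< (suc n) (A n) ⊕ Σ< n (λ i → A n (suc n ℕ.+ i))
    ≈⟨ ⊕-cong (≈-refl {Σ< (suc n) (A n)})
              (≈-trans (Σ<-reverse n (λ i → A n (suc n ℕ.+ i))) (≈-trans (Σ<-cong n (A-reflect n)) (Σ<-neg n (B n)))) ⟩
  Σ< (suc n) (A n) ⊖ Σ< n (B n) ∎
  where
  open ≈-Reasoning
  2n+1≡ : ∀ n → suc (2 ℕ.* n) ≡ suc n ℕ.+ n
  2n+1≡ = solve-∀

summandSum≈minusqPoch : ∀ n → summandSum n ≈ minusqPoch (2 ℕ.* n)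
summandSum≈minusqPoch n = ⊗-cancelʳ (summandSum n) (minusqPoch N) oneMinusq refl (begin
  summandSum n ⊗ oneMinusq
    ≈⟨ ≈-trans (⊗-comm (summandSum n) oneMinusq) (oneMinusq⊗summandSum n) ⟩
  Σ< (suc n) (A n) ⊖ Σ< n (B n)
    ≈⟨ ≈-sym (≈-trans (gaussSum-difference n) (Σ<-A n)) ⟩
  gaussSum 3 N ⊖ X^ (2 ℕ.* n ℕ.+ 1) ⊗ gaussSum 1 N
    ≈⟨ ⊖-cong (proj₂ (gaussSum-closed N)) (⊗-cong (X^-≡ (ℕP.+-comm N 1)) (proj₁ (gaussSum-closed N))) ⟩
  (𝟙 ⊖ X^ 1 ⊕ X^ (suc N)) ⊗ minusqPoch N ⊖ X^ (suc N) ⊗ minusqPoch N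
    ≈⟨ solve 4 (λ o x y p → ((o :- x :+ y) :* p :- y :* p) := (p :* (o :- x))) ≈-refl 𝟙 (X^ 1) (X^ (suc N)) (minusqPoch N) ⟩
  minusqPoch N ⊗ oneMinusq ∎)
  where
  open ≈-Reasoning
  N = 2 ℕ.* n

qPoch : ℕ → FPS
qPoch M = poch (+ 1) 1 1 M

q²Poch≈qPoch⊗minusqPoch : ∀ M → poch (+ 1) 2 2 M ≈ qPoch M ⊗ minusqPoch M
q²Poch≈qPoch⊗minusqPoch zero    = ≈-sym (⊗-identityˡ 𝟙)
q²Poch≈qPoch⊗minusqPoch (suc M) = begin
  poch (+ 1) 2 2 M ⊗ (𝟙 ⊖ (+ 1) · X^ (2 ℕ.+ 2 ℕ.* M))
    ≈⟨ ⊗-cong (q²Poch≈qPoch⊗minusqPoch M)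
              (⊖-cong 𝟙≈con1 (≈-trans (·-identityˡ _) (≈-trans (X^-≡ (exponent M)) (≈-sym (X^-+ (suc M) (suc M)))))) ⟩
  qPoch M ⊗ minusqPoch M ⊗ ((+ 1) · 𝟙 ⊖ y ⊗ y)
    ≈⟨ solve 3 (λ a b y → (a :* b :* (con (+ 1) :- y :* y)) := ((a :* (con (+ 1) :- y)) :* (b :* (con (+ 1) :+ y))))
               ≈-refl (qPoch M) (minusqPoch M) y ⟩
  (qPoch M ⊗ ((+ 1) · 𝟙 ⊖ y)) ⊗ (minusqPoch M ⊗ ((+ 1) · 𝟙 ⊕ y))
    ≈⟨ ⊗-cong (⊗-congʳ (qPoch M) (⊖-cong (≈-sym 𝟙≈con1)
                                           (≈-trans (X^-≡ (cong suc (Eq.sym (ℕP.+-identityʳ M)))) (≈-sym (·-identityˡ _)))))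
              (≈-trans (⊗-congʳ (minusqPoch M) (⊕-cong (≈-sym 𝟙≈con1) (≈-refl {y}))) (≈-sym (minusqPoch-suc M))) ⟩
  qPoch (suc M) ⊗ minusqPoch (suc M) ∎
  where
  open ≈-Reasoning
  y = X^ (suc M)
  exponent : ∀ M → 2 ℕ.+ 2 ℕ.* M ≡ suc M ℕ.+ suc M
  exponent = solve-∀

evenExponent : ℕ → ℕ
evenExponent n = n ℕ.* (2 ℕ.* n ∸ 1)

eulerTerm : ℕ → FPS
eulerTerm n = X^ (evenExponent n) ⊗ inv (qPoch (2 ℕ.* n))

term≈ : ∀ n k → term n k ≈ (X^ (evenExponent n) ⊗ inv (poch (+ 1) 2 2 (2 ℕ.* n))) ⊗ summand n k
term≈ n k = begin
  X^ (evenExponent n ℕ.+ 3 ℕ.* k) ⊗ Y ⊗ I ⊗ Q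
    ≈⟨ ⊗-congˡ Q (⊗-congˡ I (⊗-congˡ Y (≈-sym (X^-+ (evenExponent n) (3 ℕ.* k))))) ⟩
  X^ (evenExponent n) ⊗ X^ (3 ℕ.* k) ⊗ Y ⊗ I ⊗ Q
    ≈⟨ solve 5 (λ a b y i q → (a :* b :* y :* i :* q) := ((a :* i) :* (b :* y :* q))) ≈-refl
         (X^ (evenExponent n)) (X^ (3 ℕ.* k)) Y I Q ⟩
  (X^ (evenExponent n) ⊗ I) ⊗ summand n k ∎
  where
  open ≈-Reasoning
  Y = Yam 2 (2 ℕ.* n ∸ k) k
  I = inv (poch (+ 1) 2 2 (2 ℕ.* n))
  Q = qint 1 (suc (2 ℕ.* (n ∸ k)))

Σ<-term : ∀ n → Σ< (suc n) (term n) ≈ eulerTerm n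
Σ<-term n = begin
  Σ< (suc n) (term n)
    ≈⟨ ≈-trans (Σ<-cong (suc n) (λ k _ → term≈ n k)) (≈-sym (⊗-Σ< (suc n) C (summand n))) ⟩
  C ⊗ summandSum n
    ≈⟨ ⊗-congʳ C (summandSum≈minusqPoch n) ⟩
  x ⊗ inv (poch (+ 1) 2 2 M) ⊗ minusqPoch M
    ≈⟨ ⊗-congˡ (minusqPoch M) (⊗-congʳ x (≈-trans
         (inv-cong (ConstOne-⊗ {qPoch M} {minusqPoch M} qPoch₀ minusqPoch₀) (q²Poch≈qPoch⊗minusqPoch M))
         (inv-⊗ (qPoch M) (minusqPoch M) qPoch₀ minusqPoch₀))) ⟩
  x ⊗ (inv (qPoch M) ⊗ inv (minusqPoch M)) ⊗ minusqPoch M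
    ≈⟨ solve 4 (λ x a b p → (x :* (a :* b) :* p) := ((x :* a) :* (p :* b))) ≈-refl x (inv (qPoch M)) (inv (minusqPoch M)) (minusqPoch M) ⟩
  (x ⊗ inv (qPoch M)) ⊗ (minusqPoch M ⊗ inv (minusqPoch M))
    ≈⟨ ≈-trans (⊗-congʳ (x ⊗ inv (qPoch M)) (⊗-inv (minusqPoch M) minusqPoch₀)) (⊗-identityʳ _) ⟩
  eulerTerm n ∎
  where
  open ≈-Reasoning
  M = 2 ℕ.* n
  x = X^ (evenExponent n)
  C = x ⊗ inv (poch (+ 1) 2 2 M)
  qPoch₀ = ConstOne-poch (+ 1) 0 1 M
  minusqPoch₀ = ConstOne-poch (- (+ 1)) 0 1 M

-- The even and odd parts of Σₘ q^{m(m−1)/2} [M m]_q are both (−q;q)_{M−1}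

evenTerm : ℕ → ℕ → FPS
evenTerm M n = X^ (evenExponent n) ⊗ gauss 1 M (2 ℕ.* n)

oddTerm : ℕ → ℕ → FPS
oddTerm M n = X^ (n ℕ.* suc (2 ℕ.* n)) ⊗ gauss 1 M (suc (2 ℕ.* n))

evenSum : ℕ → FPS
evenSum M = Σ< (suc M) (evenTerm M)

oddSum : ℕ → FPS
oddSum M = Σ< (suc M) (oddTerm M)

X^⊗X^⊗gauss-above : ∀ a b M j → M ℕ.< j → X^ a ⊗ (X^ b ⊗ gauss 1 M j) ≈ 𝟘
X^⊗X^⊗gauss-above a b M j M<j =
  ≈-trans (⊗-congʳ (X^ a) (≈-trans (⊗-congʳ (X^ b) (gauss-above 1 M j M<j)) (⊗-zeroʳ (X^ b)))) (⊗-zeroʳ (X^ a))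

evenTerm-suc : ∀ M n → evenTerm (suc M) (suc n) ≈ X^ M ⊗ oddTerm M n ⊕ evenTerm M (suc n)
evenTerm-suc M n = begin
  X^ c ⊗ gauss 1 (suc M) (2 ℕ.* suc n)
    ≈⟨ ⊗-congʳ (X^ c) (≈-trans (gauss-≡ʲ 1 (suc M) (2[1+n] n)) (gauss-pascal′ 0 M (suc (2 ℕ.* n)))) ⟩
  X^ c ⊗ (X^ (1 ℕ.* (M ∸ suc (2 ℕ.* n))) ⊗ G ⊕ gauss 1 M (suc (suc (2 ℕ.* n))))
    ≈⟨ ⊗-distribˡ (X^ c) (X^ (1 ℕ.* (M ∸ suc (2 ℕ.* n))) ⊗ G) (gauss 1 M (suc (suc (2 ℕ.* n)))) ⟩
  X^ c ⊗ (X^ (1 ℕ.* (M ∸ suc (2 ℕ.* n))) ⊗ G) ⊕ X^ c ⊗ gauss 1 M (suc (suc (2 ℕ.* n)))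
    ≈⟨ ⊕-cong shift (⊗-congʳ (X^ c) (gauss-≡ʲ 1 M (Eq.sym (2[1+n] n)))) ⟩
  X^ M ⊗ oddTerm M n ⊕ evenTerm M (suc n) ∎
  where
  open ≈-Reasoning
  c = evenExponent (suc n)
  G = gauss 1 M (suc (2 ℕ.* n))
  2[1+n] : ∀ n → 2 ℕ.* suc n ≡ suc (suc (2 ℕ.* n))
  2[1+n] = solve-∀
  exponents : ∀ n e → suc n ℕ.* (n ℕ.+ suc (n ℕ.+ 0)) ℕ.+ 1 ℕ.* e ≡ (suc (2 ℕ.* n) ℕ.+ e) ℕ.+ n ℕ.* suc (2 ℕ.* n)
  exponents = solve-∀
  shift : X^ c ⊗ (X^ (1 ℕ.* (M ∸ suc (2 ℕ.* n))) ⊗ G) ≈ X^ M ⊗ oddTerm M n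
  shift with suc (2 ℕ.* n) ℕ.≤? M
  ... | yes 2n<M = X^-swap c _ M _ G
                     (Eq.trans (exponents n (M ∸ suc (2 ℕ.* n))) (cong (ℕ._+ n ℕ.* suc (2 ℕ.* n)) (ℕP.m+[n∸m]≡n 2n<M)))
  ... | no 2n≮M = ≈-trans (X^⊗X^⊗gauss-above c (1 ℕ.* (M ∸ suc (2 ℕ.* n))) M (suc (2 ℕ.* n)) (ℕP.≰⇒> 2n≮M))
                          (≈-sym (X^⊗X^⊗gauss-above M (n ℕ.* suc (2 ℕ.* n)) M (suc (2 ℕ.* n)) (ℕP.≰⇒> 2n≮M)))

oddTerm-suc : ∀ M n → oddTerm (suc M) n ≈ X^ M ⊗ evenTerm M n ⊕ oddTerm M n
oddTerm-suc M n = begin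
  X^ d ⊗ gauss 1 (suc M) (suc (2 ℕ.* n))
    ≈⟨ ⊗-congʳ (X^ d) (gauss-pascal′ 0 M (2 ℕ.* n)) ⟩
  X^ d ⊗ (X^ (1 ℕ.* (M ∸ 2 ℕ.* n)) ⊗ G ⊕ gauss 1 M (suc (2 ℕ.* n)))
    ≈⟨ ⊗-distribˡ (X^ d) (X^ (1 ℕ.* (M ∸ 2 ℕ.* n)) ⊗ G) (gauss 1 M (suc (2 ℕ.* n))) ⟩
  X^ d ⊗ (X^ (1 ℕ.* (M ∸ 2 ℕ.* n)) ⊗ G) ⊕ oddTerm M n
    ≈⟨ ⊕-cong shift (≈-refl {oddTerm M n}) ⟩
  X^ M ⊗ evenTerm M n ⊕ oddTerm M n ∎
  where
  open ≈-Reasoning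
  d = n ℕ.* suc (2 ℕ.* n)
  G = gauss 1 M (2 ℕ.* n)
  exponents′ : ∀ n e → suc n ℕ.* suc (2 ℕ.* suc n) ℕ.+ 1 ℕ.* e ≡ (2 ℕ.* suc n ℕ.+ e) ℕ.+ suc n ℕ.* (n ℕ.+ suc (n ℕ.+ 0))
  exponents′ = solve-∀
  exponents₀ : ∀ e → 0 ℕ.* suc (2 ℕ.* 0) ℕ.+ 1 ℕ.* e ≡ (2 ℕ.* 0 ℕ.+ e) ℕ.+ 0
  exponents₀ = solve-∀
  exponents : ∀ n e → n ℕ.* suc (2 ℕ.* n) ℕ.+ 1 ℕ.* e ≡ (2 ℕ.* n ℕ.+ e) ℕ.+ evenExponent n
  exponents zero    e = exponents₀ e
  exponents (suc n) e = exponents′ n e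
  shift : X^ d ⊗ (X^ (1 ℕ.* (M ∸ 2 ℕ.* n)) ⊗ G) ≈ X^ M ⊗ evenTerm M n
  shift with 2 ℕ.* n ℕ.≤? M
  ... | yes 2n≤M = X^-swap d _ M _ G (Eq.trans (exponents n (M ∸ 2 ℕ.* n)) (cong (ℕ._+ evenExponent n) (ℕP.m+[n∸m]≡n 2n≤M)))
  ... | no 2n≰M = ≈-trans (X^⊗X^⊗gauss-above d (1 ℕ.* (M ∸ 2 ℕ.* n)) M (2 ℕ.* n) (ℕP.≰⇒> 2n≰M))
                          (≈-sym (X^⊗X^⊗gauss-above M (evenExponent n) M (2 ℕ.* n) (ℕP.≰⇒> 2n≰M)))

M<2[1+M] : ∀ M → M ℕ.< 2 ℕ.* suc M
M<2[1+M] M = ℕP.≤-trans (ℕP.n≤1+n (suc M)) (ℕP.≤-trans (s≤s (s≤s (ℕP.m≤m+n M (M ℕ.+ 0)))) (ℕP.≤-reflexive (2[1+M] M)))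
  where
  2[1+M] : ∀ M → suc (suc (M ℕ.+ (M ℕ.+ 0))) ≡ 2 ℕ.* suc M
  2[1+M] = solve-∀

evenSum-suc : ∀ M → evenSum (suc M) ≈ evenSum M ⊕ X^ M ⊗ oddSum M
evenSum-suc M = begin
  evenSum (suc M)
    ≈⟨ Σ<-suc (suc M) (evenTerm (suc M)) ⟩
  X^ 0 ⊗ 𝟙 ⊕ Σ< (suc M) (λ n → evenTerm (suc M) (suc n))
    ≈⟨ ⊕-cong (≈-refl {X^ 0 ⊗ 𝟙}) (≈-trans (Σ<-cong (suc M) (λ n _ → evenTerm-suc M n)) (Σ<-⊕ (suc M) _ _)) ⟩
  X^ 0 ⊗ 𝟙 ⊕ (Σ< (suc M) (λ n → X^ M ⊗ oddTerm M n) ⊕ (Σ< M E′ ⊕ evenTerm M (suc M)))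
    ≈⟨ ⊕-cong (≈-refl {X^ 0 ⊗ 𝟙}) (⊕-cong (≈-sym (⊗-Σ< (suc M) (X^ M) (oddTerm M)))
                                          (≈-trans (⊕-cong (≈-refl {Σ< M E′}) last-term) (⊕-identityʳ (Σ< M E′)))) ⟩
  X^ 0 ⊗ 𝟙 ⊕ (X^ M ⊗ oddSum M ⊕ Σ< M E′)
    ≈⟨ solve 3 (λ a b c → (a :+ (b :+ c)) := ((a :+ c) :+ b)) ≈-refl (X^ 0 ⊗ 𝟙) (X^ M ⊗ oddSum M) (Σ< M E′) ⟩
  (X^ 0 ⊗ 𝟙 ⊕ Σ< M E′) ⊕ X^ M ⊗ oddSum M
    ≈⟨ ⊕-cong (≈-trans (⊕-cong (⊗-congʳ (X^ 0) (≈-sym (gauss-0 1 M))) (≈-refl {Σ< M E′})) (≈-sym (Σ<-suc M (evenTerm M))))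
              (≈-refl {X^ M ⊗ oddSum M}) ⟩
  evenSum M ⊕ X^ M ⊗ oddSum M ∎
  where
  open ≈-Reasoning
  E′ = λ n → evenTerm M (suc n)
  last-term : evenTerm M (suc M) ≈ 𝟘
  last-term = ≈-trans (⊗-congʳ (X^ (evenExponent (suc M))) (gauss-above 1 M (2 ℕ.* suc M) (M<2[1+M] M)))
                      (⊗-zeroʳ (X^ (evenExponent (suc M))))

oddSum-suc : ∀ M → oddSum (suc M) ≈ X^ M ⊗ evenSum M ⊕ oddSum M
oddSum-suc M = begin
  Σ< (suc M) (oddTerm (suc M)) ⊕ oddTerm (suc M) (suc M)
    ≈⟨ ⊕-cong (≈-trans (Σ<-cong (suc M) (λ n _ → oddTerm-suc M n)) (Σ<-⊕ (suc M) (λ n → X^ M ⊗ evenTerm M n) (oddTerm M)))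
              last-term ⟩
  Σ< (suc M) (λ n → X^ M ⊗ evenTerm M n) ⊕ oddSum M ⊕ 𝟘
    ≈⟨ ⊕-identityʳ _ ⟩
  Σ< (suc M) (λ n → X^ M ⊗ evenTerm M n) ⊕ oddSum M
    ≈⟨ ⊕-cong (≈-sym (⊗-Σ< (suc M) (X^ M) (evenTerm M))) (≈-refl {oddSum M}) ⟩
  X^ M ⊗ evenSum M ⊕ oddSum M ∎
  where
  open ≈-Reasoning
  d = suc M ℕ.* suc (2 ℕ.* suc M)
  last-term : oddTerm (suc M) (suc M) ≈ 𝟘
  last-term = ≈-trans (⊗-congʳ (X^ d) (gauss-above 1 (suc M) (suc (2 ℕ.* suc M)) (s≤s (M<2[1+M] M)))) (⊗-zeroʳ (X^ d))

evenSum×oddSum≈minusqPoch : ∀ M → evenSum (suc M) ≈ minusqPoch M × oddSum (suc M) ≈ minusqPoch M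
evenSum×oddSum≈minusqPoch zero =
  ≈-trans (evenSum-suc 0) (≈-trans (⊕-cong evenSum₀ (≈-trans (⊗-congʳ (X^ 0) oddSum₀) (⊗-zeroʳ (X^ 0)))) (⊕-identityʳ 𝟙)) ,
  ≈-trans (oddSum-suc 0) (≈-trans (⊕-cong (≈-trans (⊗-congʳ (X^ 0) evenSum₀) (≈-trans (⊗-identityʳ (X^ 0)) X^0≈𝟙)) oddSum₀)
                                  (⊕-identityʳ 𝟙))
  where
  evenSum₀ : evenSum 0 ≈ 𝟙
  evenSum₀ n = Eq.trans (ℤP.+-identityˡ _) (Eq.trans (⊗-identityʳ (X^ 0) n) (X^0≈𝟙 n))
  oddSum₀ : oddSum 0 ≈ 𝟘
  oddSum₀ n = Eq.trans (ℤP.+-identityˡ _) (⊗-zeroʳ (X^ 0) n)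
evenSum×oddSum≈minusqPoch (suc M) =
  ≈-trans (evenSum-suc (suc M)) (≈-trans (⊕-cong IH-even (⊗-congʳ y IH-odd)) p⊕y⊗p) ,
  ≈-trans (oddSum-suc (suc M)) (≈-trans (⊕-cong (⊗-congʳ y IH-even) IH-odd)
                               (≈-trans (λ n → ℤP.+-comm ((y ⊗ minusqPoch M) n) (minusqPoch M n)) p⊕y⊗p))
  where
  IH-even = proj₁ (evenSum×oddSum≈minusqPoch M)
  IH-odd = proj₂ (evenSum×oddSum≈minusqPoch M)
  y = X^ (suc M)
  p⊕y⊗p : minusqPoch M ⊕ y ⊗ minusqPoch M ≈ minusqPoch (suc M)
  p⊕y⊗p = ≈-sym (≈-trans (minusqPoch-suc M) (≈-trans (⊗-distribˡ (minusqPoch M) 𝟙 y)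
                                                     (⊕-cong (⊗-identityʳ (minusqPoch M)) (⊗-comm (minusqPoch M) y))))

-- Truncation: [j+m j]_q ≡ 1/(q;q)_j modulo q^{m+1}

AgreeBelow : ℕ → FPS → FPS → Set
AgreeBelow K f g = ∀ i → i ℕ.< K → f i ≡ g i

≈⇒AgreeBelow : ∀ {K f g} → f ≈ g → AgreeBelow K f g
≈⇒AgreeBelow f≈g i _ = f≈g i

AgreeBelow-trans : ∀ {K f g h} → AgreeBelow K f g → AgreeBelow K g h → AgreeBelow K f h
AgreeBelow-trans f≡g g≡h i i<K = Eq.trans (f≡g i i<K) (g≡h i i<K)

AgreeBelow-⊗ : ∀ {K f f′ g g′} → AgreeBelow K f f′ → AgreeBelow K g g′ → AgreeBelow K (f ⊗ g) (f′ ⊗ g′)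
AgreeBelow-⊗ {K} {f} {f′} {g} {g′} f≡f′ g≡g′ i i<K = Eq.trans (⊗-coeff f g i) (Eq.trans
  (∑-cong (suc i) (λ j j≤i → cong₂ _*_ (f≡f′ j (ℕP.≤-<-trans (ℕP.≤-pred j≤i) i<K))
                                        (g≡g′ (i ∸ j) (ℕP.≤-<-trans (ℕP.m∸n≤m i j) i<K))))
  (Eq.sym (⊗-coeff f′ g′ i)))

X^⊗-coeff-agree : ∀ {K f g} a n → AgreeBelow K f g → n ∸ a ℕ.< K → (X^ a ⊗ f) n ≡ (X^ a ⊗ g) n
X^⊗-coeff-agree {K} {f} {g} a n f≡g n-a<K with a ℕ.≤? n
... | yes a≤n = Eq.trans (X^⊗-coeff a f n a≤n) (Eq.trans (f≡g (n ∸ a) n-a<K) (Eq.sym (X^⊗-coeff a g n a≤n)))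
... | no a≰n  = Eq.trans (X^⊗-coeff-below a f n (ℕP.≰⇒> a≰n)) (Eq.sym (X^⊗-coeff-below a g n (ℕP.≰⇒> a≰n)))

oneMinusq^ : ℕ → FPS
oneMinusq^ M = ∏< M (λ _ → oneMinusq)

oneMinusq^-+ : ∀ j m → oneMinusq^ (j ℕ.+ m) ≈ oneMinusq^ j ⊗ oneMinusq^ m
oneMinusq^-+ j zero    = ≈-trans (∏<-≡ (λ _ → oneMinusq) (ℕP.+-identityʳ j)) (≈-sym (⊗-identityʳ (oneMinusq^ j)))
oneMinusq^-+ j (suc m) = ≈-trans (∏<-≡ (λ _ → oneMinusq) (ℕP.+-suc j m))
  (≈-trans (⊗-congˡ oneMinusq (oneMinusq^-+ j m)) (⊗-assoc (oneMinusq^ j) (oneMinusq^ m) oneMinusq))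

qPoch≈oneMinusq^⊗qfact : ∀ M → qPoch M ≈ oneMinusq^ M ⊗ qfact 1 M
qPoch≈oneMinusq^⊗qfact zero    = ≈-sym (⊗-identityˡ 𝟙)
qPoch≈oneMinusq^⊗qfact (suc M) = ≈-trans (⊗-cong (qPoch≈oneMinusq^⊗qfact M) factor)
  (solve 4 (λ a b c d → (a :* b :* (c :* d)) := ((a :* c) :* (b :* d))) ≈-refl
     (oneMinusq^ M) (qfact 1 M) oneMinusq (qint 1 (suc M)))
  where
  factor : 𝟙 ⊖ (+ 1) · X^ (1 ℕ.+ 1 ℕ.* M) ≈ oneMinusq ⊗ qint 1 (suc M)
  factor = ≈-trans (⊖-cong (≈-refl {𝟙}) (≈-trans (·-identityˡ _) (X^-≡ (cong suc (ℕP.*-identityˡ M)))))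
                   (≈-sym (oneMinusq⊗qint (suc M)))

-- (q^{m+1}; q)_j, the factor by which (q;q)_{m+j} exceeds (q;q)_m
tailPoch : ℕ → ℕ → FPS
tailPoch m j = ∏< j (λ i → 𝟙 ⊖ (+ 1) · X^ (1 ℕ.+ 1 ℕ.* (m ℕ.+ i)))

tailPoch-agree-𝟙 : ∀ m j → AgreeBelow (suc m) (tailPoch m j) 𝟙
tailPoch-agree-𝟙 m zero    = λ i _ → refl
tailPoch-agree-𝟙 m (suc j) = AgreeBelow-trans (AgreeBelow-⊗ (tailPoch-agree-𝟙 m j) factor) (≈⇒AgreeBelow (⊗-identityˡ 𝟙))
  where
  factor : AgreeBelow (suc m) (𝟙 ⊖ (+ 1) · X^ (1 ℕ.+ 1 ℕ.* (m ℕ.+ j))) 𝟙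
  factor i i≤m = Eq.trans (cong (λ z → 𝟙 i - (+ 1) * z) (X^-below i<)) (ℤP.+-identityʳ (𝟙 i))
    where
    i< : i ℕ.< 1 ℕ.+ 1 ℕ.* (m ℕ.+ j)
    i< = ℕP.≤-trans i≤m (s≤s (ℕP.≤-trans (ℕP.m≤m+n m j) (ℕP.≤-reflexive (Eq.sym (ℕP.*-identityˡ (m ℕ.+ j))))))

gauss⊗qPoch : ∀ j m → gauss 1 (j ℕ.+ m) j ⊗ qPoch j ≈ tailPoch m j
gauss⊗qPoch j m = ⊗-cancelʳ _ _ (qPoch m) (ConstOne-poch (+ 1) 0 1 m) (begin
  G ⊗ qPoch j ⊗ qPoch m
    ≈⟨ ⊗-cong (⊗-congʳ G (qPoch≈oneMinusq^⊗qfact j)) (qPoch≈oneMinusq^⊗qfact m) ⟩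
  G ⊗ (oneMinusq^ j ⊗ qfact 1 j) ⊗ (oneMinusq^ m ⊗ qfact 1 m)
    ≈⟨ solve 5 (λ g a b c d → (g :* (a :* b) :* (c :* d)) := ((g :* (b :* d)) :* (a :* c))) ≈-refl
         G (oneMinusq^ j) (qfact 1 j) (oneMinusq^ m) (qfact 1 m) ⟩
  (G ⊗ (qfact 1 j ⊗ qfact 1 m)) ⊗ (oneMinusq^ j ⊗ oneMinusq^ m)
    ≈⟨ ⊗-cong (gauss⊗qfacts 1 j m) (≈-sym (oneMinusq^-+ j m)) ⟩
  qfact 1 (j ℕ.+ m) ⊗ oneMinusq^ (j ℕ.+ m)
    ≈⟨ ≈-trans (⊗-comm (qfact 1 (j ℕ.+ m)) (oneMinusq^ (j ℕ.+ m))) (≈-sym (qPoch≈oneMinusq^⊗qfact (j ℕ.+ m))) ⟩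
  qPoch (j ℕ.+ m)
    ≈⟨ ≈-trans (∏<-≡ _ (ℕP.+-comm j m)) (∏<-split m j _) ⟩
  qPoch m ⊗ tailPoch m j
    ≈⟨ ⊗-comm (qPoch m) (tailPoch m j) ⟩
  tailPoch m j ⊗ qPoch m ∎)
  where
  open ≈-Reasoning
  G = gauss 1 (j ℕ.+ m) j

gauss-agree-inv-qPoch : ∀ j m → AgreeBelow (suc m) (gauss 1 (j ℕ.+ m) j) (inv (qPoch j))
gauss-agree-inv-qPoch j m =
  AgreeBelow-trans (≈⇒AgreeBelow (≈-sym (⊗-inv-exact _ (qPoch j) _ (ConstOne-poch (+ 1) 0 1 j) (gauss⊗qPoch j m))))
  (AgreeBelow-trans (AgreeBelow-⊗ {g = inv (qPoch j)} (tailPoch-agree-𝟙 m j) (λ _ _ → refl))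
                    (≈⇒AgreeBelow (⊗-identityˡ (inv (qPoch j)))))

2n∸1≤evenExponent : ∀ n → 2 ℕ.* n ∸ 1 ℕ.≤ evenExponent n
2n∸1≤evenExponent zero    = z≤n
2n∸1≤evenExponent (suc n) = ℕP.m≤n*m (2 ℕ.* suc n ∸ 1) (suc n)

2n≤evenExponent+1 : ∀ n → 2 ℕ.* n ℕ.≤ evenExponent n ℕ.+ 1
2n≤evenExponent+1 zero    = z≤n
2n≤evenExponent+1 (suc n) = ℕP.≤-trans (ℕP.≤-reflexive (Eq.sym (ℕP.m∸n+n≡m {2 ℕ.* suc n} {1} (s≤s z≤n))))
                                       (ℕP.+-monoˡ-≤ 1 (2n∸1≤evenExponent (suc n)))

-- The exponent n(2n−1) exceeds N whenever [N+1 2n] differs from 1/(q;q)_{2n} in degree ≤ N.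
evenTerm-coeff : ∀ N n → evenTerm (suc N) n N ≡ eulerTerm n N
evenTerm-coeff N n with 2 ℕ.* n ℕ.≤? suc N
... | yes 2n≤1+N = X^⊗-coeff-agree (evenExponent n) N
                     (AgreeBelow-trans (≈⇒AgreeBelow (gauss-≡ 1 (2 ℕ.* n) (Eq.sym 2n+m≡1+N))) (gauss-agree-inv-qPoch (2 ℕ.* n) m))
                     N-e<1+m
  where
  m = suc N ∸ 2 ℕ.* n
  2n+m≡1+N : 2 ℕ.* n ℕ.+ m ≡ suc N
  2n+m≡1+N = ℕP.m+[n∸m]≡n 2n≤1+N
  1+N≤1+e+m : suc N ℕ.≤ suc (evenExponent n ℕ.+ m)
  1+N≤1+e+m = ℕP.≤-trans (ℕP.≤-reflexive (Eq.sym 2n+m≡1+N))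
              (ℕP.≤-trans (ℕP.+-monoˡ-≤ m (2n≤evenExponent+1 n)) (ℕP.≤-reflexive (rearrange (evenExponent n) m)))
    where rearrange : ∀ e m → e ℕ.+ 1 ℕ.+ m ≡ suc (e ℕ.+ m)
          rearrange = solve-∀
  N-e<1+m : N ∸ evenExponent n ℕ.< suc m
  N-e<1+m = s≤s (ℕP.≤-trans (ℕP.∸-monoˡ-≤ (evenExponent n) (ℕP.≤-pred 1+N≤1+e+m))
                            (ℕP.≤-reflexive (ℕP.m+n∸m≡n (evenExponent n) m)))
... | no 2n≰1+N = Eq.trans (⊗-congʳ (X^ (evenExponent n)) (gauss-above 1 (suc N) (2 ℕ.* n) (ℕP.≰⇒> 2n≰1+N)) N)
                   (Eq.trans (⊗-zeroʳ (X^ (evenExponent n)) N)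
                             (Eq.sym (X^⊗-coeff-below (evenExponent n) (inv (qPoch (2 ℕ.* n))) N N<e)))
  where
  N<e : N ℕ.< evenExponent n
  N<e = ℕP.≤-trans (ℕP.∸-monoˡ-≤ 1 (ℕP.≰⇒> 2n≰1+N)) (2n∸1≤evenExponent n)

evenSum-coeff : ∀ N → evenSum (suc N) N ≡ ∑ (suc N) (λ n → evenTerm (suc N) n N)
evenSum-coeff N = Eq.trans (Σ<-coeff (suc (suc N)) (evenTerm (suc N)) N)
  (Eq.trans (cong (λ z → ∑ (suc N) (λ n → evenTerm (suc N) n N) + z) last-term) (ℤP.+-identityʳ _))
  where
  last-term : evenTerm (suc N) (suc N) N ≡ + 0
  last-term = Eq.trans (⊗-congʳ (X^ (evenExponent (suc N))) (gauss-above 1 (suc N) (2 ℕ.* suc N) N+1<2[N+1]) N)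
                       (⊗-zeroʳ (X^ (evenExponent (suc N))) N)
    where
    N+1<2[N+1] : suc N ℕ.< 2 ℕ.* suc N
    N+1<2[N+1] = ℕP.≤-trans (ℕP.m<m+n (suc N) (s≤s (z≤n {N}))) (ℕP.≤-reflexive (cong (suc N ℕ.+_) (Eq.sym (ℕP.+-identityʳ (suc N)))))

⊗[𝟙⊕X^]-coeff : ∀ f a n → n ℕ.< a → (f ⊗ (𝟙 ⊕ X^ a)) n ≡ f n
⊗[𝟙⊕X^]-coeff f a n n<a = Eq.trans (⊗-distribˡ f 𝟙 (X^ a) n) (Eq.trans
  (cong₂ _+_ (⊗-identityʳ f n) (Eq.trans (⊗-comm f (X^ a) n) (X^⊗-coeff-below a f n n<a)))
  (ℤP.+-identityʳ (f n)))

minusqInf-coeff : ∀ N → minusqInf N ≡ minusqPoch N N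
minusqInf-coeff N = Eq.trans (minusqPoch-suc N N) (⊗[𝟙⊕X^]-coeff (minusqPoch N) (suc N) N ℕP.≤-refl)

Σ-n≥k≡∑ : ∀ T N → Σ-n≥k T N ≡ ∑ (suc N) (λ n → Σ< (suc n) (T n) N)
Σ-n≥k≡∑ T N = Eq.trans (Σ≤≡∑ N _)
  (∑-cong (suc N) (λ n _ → Eq.trans (Σ≤≡∑ n _) (Eq.sym (Σ<-coeff (suc n) (T n) N))))

theorem1p16 : (N : ℕ) → minusqInf N ≡ Σ-n≥k term N
theorem1p16 N = begin
  minusqInf N                               ≡⟨ minusqInf-coeff N ⟩
  minusqPoch N N                            ≡⟨ Eq.sym (proj₁ (evenSum×oddSum≈minusqPoch N) N) ⟩
  evenSum (suc N) N                         ≡⟨ evenSum-coeff N ⟩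
  ∑ (suc N) (λ n → evenTerm (suc N) n N)    ≡⟨ ∑-cong (suc N) (λ n _ → evenTerm-coeff N n) ⟩
  ∑ (suc N) (λ n → eulerTerm n N)           ≡⟨ ∑-cong (suc N) (λ n _ → Eq.sym (Σ<-term n N)) ⟩
  ∑ (suc N) (λ n → Σ< (suc n) (term n) N)   ≡⟨ Eq.sym (Σ-n≥k≡∑ term N) ⟩
  Σ-n≥k term N                              ∎
  where open Eq.≡-Reasoning
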